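{- For all $\alpha\in\widehat{\mathfrak{h}}^1$, we have $\Phi_1(\alpha)-\psi_1(\alpha)\in\ker(\hat{\zeta}_\infty)$.
   Context: A composition is a finite ordered tuple $\mathbf{s}=(s_1,\ldots,s_k)$ of positive integers (empty allowed), with weight $w(\mathbf{s})=\sum s_i$ and reversal $\overline{\mathbf{s}}=(s_k,\ldots,s_1)$. $H_n(\mathbf{s})=\sum_{n\geq n_1>\cdots>n_k\geq1}n_1^{ -s_1}\cdots n_k^{ -s_k}$, $H_n(\varnothing)=1$. Let $\widehat{\mathfrak{h}}$ be the ring of formal noncommutative power series over $\mathbb{Q}$ in $x,y$ (completed by degree), and $\widehat{\mathfrak{h}}^1$ the closed subspace of formal sums $\sum_{\mathbf{s}}\alpha_{\mathbf{s}}z_{\mathbf{s}}$, $\alpha_{\mathbf{s}}\in\mathbb{Q}$, where $z_n=x^{n-1}y$ and $z_{\mathbf{s}}=z_{s_1}\cdots z_{s_k}$ (concatenation), $z_\varnothing=1$. $\psi_1:\widehat{\mathfrak{h}}^1\to\widehat{\mathfrak{h}}^1$ is the continuous linear map $\sum_{\mathbf{s}}\alpha_{\mathbf{s}}z_{\mathbf{s}}\mapsto\sum_{\mathbf{s}}(-1)^{w(\mathbf{s})}\alpha_{\mathbf{s}}z_{\overline{\mathbf{s}}}$. $\Phi_1$ is the continuous concatenation-ring homomorphism of $\widehat{\mathfrak{h}}$ with $x\mapsto(1-x)^{ -1}x=x+x^2+\cdots$, $y\mapsto(1-x)^{ -1}y=y+xy+x^2y+\cdots$, restricted to $\widehat{\mathfrak{h}}^1$.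 For $n\geq1$ let $\mathcal{A}_n=(\prod_p\mathbb{Z}/p^n)/(\bigoplus_p\mathbb{Z}/p^n)$ over primes $p$ and $\hat{\mathcal{A}}=\varprojlim\mathcal{A}_n$. The map $\hat{\zeta}_\infty:\widehat{\mathfrak{h}}^1\to\hat{\mathcal{A}}$ sends $\sum\alpha_{\mathbf{s}}z_{\mathbf{s}}$ to the element whose image in $\mathcal{A}_n$ is the class of $\left(\sum_{w(\mathbf{s})<n}\alpha_{\mathbf{s}}p^{w(\mathbf{s})}H_{p-1}(\mathbf{s})\bmod p^n\right)_p$. Equivalently, $\sum\alpha_{\mathbf{s}}z_{\mathbf{s}}\in\ker(\hat{\zeta}_\infty)$ iff for every positive integer $n$, $\sum_{w(\mathbf{s})<n}\alpha_{\mathbf{s}}p^{w(\mathbf{s})}H_{p-1}(\mathbf{s})\equiv0\pmod{p^n}$ (i.e. lies in $p^n\mathbb{Z}_{(p)}$) for all sufficiently large primes $p$. -}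

module Defs where

open import Data.Nat as ℕ using (ℕ; zero; suc; _≤_; _∸_)
open import Data.Nat.Divisibility using (_∣_)
open import Data.Nat.Primality using (Prime)
open import Data.Integer as ℤ using (ℤ; +_)
open import Data.Rational using (ℚ; 0ℚ; 1ℚ; _+_; _*_; _-_; -_; _/_; ↥_; ↧ₙ_)
open import Data.List using (List; []; _∷_; _++_; map; foldr; concatMap; reverse; length; upTo)
open import Data.Maybe using (Maybe; just; nothing)
import Data.Maybe as Maybe
open import Data.Product using (_×_; ∃-syntax)
open import Relation.Nullary using (¬_)

record ℕ⁺ : Set where
  constructor 1+_
  field pred : ℕ

val : ℕ⁺ → ℕ
val (1+ k) = suc k

Comp : Set
Comp = List ℕ⁺

weight : Comp → ℕ
weight []      = 0
weight (s ∷ ss) = val s ℕ.+ weight ss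

incHead : Comp → List Comp
incHead []             = []
incHead ((1+ k) ∷ ss)  = ((1+ suc k) ∷ ss) ∷ []

compsOfWeight : ℕ → List Comp
compsOfWeight zero    = [] ∷ []
compsOfWeight (suc w) = map ((1+ 0) ∷_) (compsOfWeight w) ++ concatMap incHead (compsOfWeight w)

Σℚ : List ℚ → ℚ
Σℚ = foldr _+_ 0ℚ

invPow : ℕ → ℕ → ℚ
invPow m zero    = 1ℚ
invPow m (suc s) = ((+ 1) / suc m) * invPow m s

ℕtoℚ : ℕ → ℚ
ℕtoℚ n = (+ n) / 1

sign : ℕ → ℚ
sign zero          = 1ℚ
sign (suc zero)    = - 1ℚ
sign (suc (suc w)) = sign w

-- Multiple harmonic sums
-- H n s = Σ_{n ≥ n₁ > ⋯ > n_k ≥ 1} n₁^{-s₁} ⋯ n_k^{-s_k},  H n ∅ = 1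
-- (recursion: H (m+1) (s₁,s') = H m (s₁,s') + (m+1)^{-s₁} H m s')

H : ℕ → Comp → ℚ
H n       []       = 1ℚ
H zero    (s ∷ ss) = 0ℚ
H (suc m) (s ∷ ss) = H m (s ∷ ss) + invPow m (val s) * H m ss

data Letter : Set where
  X Y : Letter

Word : Set
Word = List Letter

-- an element of 𝔥̂ : its coefficient function on words
Series : Set
Series = Word → ℚ

xs : ℕ → Word
xs zero    = []
xs (suc k) = X ∷ xs k

-- z_n = x^{n-1} y  and  z_s = z_{s₁} ⋯ z_{s_k}
z : Comp → Word
z []             = []
z ((1+ k) ∷ ss)  = xs k ++ (Y ∷ z ss)

decode : ℕ → Word → Maybe Comp
decode zero    []      = just []
decode (suc k) []      = nothing
decode k       (X ∷ u) = decode (suc k) u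
decode k       (Y ∷ u) = Maybe.map ((1+ k) ∷_) (decode 0 u)

-- embedding 𝔥̂¹ → 𝔥̂ : Σ α_s z_s as a series
ι : (Comp → ℚ) → Series
ι α u with decode 0 u
... | just s  = α s
... | nothing = 0ℚ

wordsOfLength : ℕ → List Word
wordsOfLength zero    = [] ∷ []
wordsOfLength (suc m) = concatMap (λ w → (X ∷ w) ∷ (Y ∷ w) ∷ []) (wordsOfLength m)

wordsUpTo : ℕ → List Word
wordsUpTo m = concatMap wordsOfLength (upTo (suc m))

-- Φ₁ : the continuous concatenation homomorphism with
--   x ↦ (1-x)⁻¹ x = Σ_{j≥0} x^j x ,  y ↦ (1-x)⁻¹ y = Σ_{j≥0} x^j y .
-- imgCoef v u = coefficient of the word u in Φ₁(v) for a word v = a₁⋯a_m,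
-- i.e. the number of ways to write u = x^{j₁} a₁ x^{j₂} a₂ ⋯ x^{j_m} a_m.
sameLetter : Letter → Letter → ℕ
sameLetter X X = 1
sameLetter Y Y = 1
sameLetter _ _ = 0

imgCoef : Word → Word → ℕ
imgCoef []      []      = 1
imgCoef []      (b ∷ u) = 0
imgCoef (a ∷ v) []      = 0
imgCoef (a ∷ v) (b ∷ u) =
  sameLetter b a ℕ.* imgCoef v u ℕ.+ sameLetter b X ℕ.* imgCoef (a ∷ v) u

-- Φ₁ on series, coefficientwise (Φ₁(v) only involves words of length ≥ |v|,
-- so the coefficient of u only receives contributions from words v with |v| ≤ |u|)
Φ₁ : Series → Series
Φ₁ f u = Σℚ (map (λ v → f v * ℕtoℚ (imgCoef v u)) (wordsUpTo (length u)))

Φ₁¹ : (Comp → ℚ) → (Comp → ℚ)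
Φ₁¹ α t = Φ₁ (ι α) (z t)

-- ψ₁ (Σ α_s z_s) = Σ (-1)^{w(s)} α_s z_{s̄}; coefficient of z_t is (-1)^{w(t)} α_{t̄}
ψ₁ : (Comp → ℚ) → (Comp → ℚ)
ψ₁ α t = sign (weight t) * α (reverse t)

-- q ∈ p^n ℤ_(p)   (q is in lowest terms)
InPowZp : ℕ → ℕ → ℚ → Set
InPowZp p n q = ¬ (p ∣ ↧ₙ q) × (p ℕ.^ n ∣ ℤ.∣ ↥ q ∣)

truncSum : (Comp → ℚ) → ℕ → ℕ → ℚ
truncSum β n p =
  Σℚ (map (λ w → Σℚ (map (λ s → β s * ℕtoℚ (p ℕ.^ w) * H (p ∸ 1) s)
                         (compsOfWeight w)))
          (upTo n))

InKerζ̂∞ : (Comp → ℚ) → Set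
InKerζ̂∞ β = ∀ (n : ℕ) → 1 ≤ n →
  ∃[ N ] (∀ (p : ℕ) → Prime p → N ≤ p → InPowZp p n (truncSum β n p))

module Submission where

-- Write L_K(s) = Σ_{w(t)<K} [z_t]Φ₁(z_s) · p^{w(t)} H_{p-1}(t) and R(s) = (-1)^{w(s)} p^{w(s)} H_{p-1}(s̄),
-- so that the n-th truncated sum of Φ₁(α) - ψ₁(α) at p is Σ_{w(s)<n} α_s (L_n(s) - R(s)).
-- The substitution n ↦ p - n shows that R(s) is H_{p-1}(s) with every factor n^{-a} replaced by ρ_n^a,
-- ρ_n = -p/(p-n). Since Φ₁(x^{a-1} y) = Σ_j (j choose a-1) x^j y, L_K(s) is H_{p-1}(s) with n^{-a}
-- replaced by Σ_j (j choose a-1) u_n^{j+1}, u_n = p/n, a truncation of the binomial expansion of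
-- (u_n/(1-u_n))^a = ρ_n^a. As p ∣ u_n for n < p, cutting the expansion off at weight K costs a multiple
-- of p^K, and induction on the range of the nested sum gives L_K(s) ≡ R(s) mod p^K. It remains to take
-- p larger than the denominators of the finitely many α_s with w(s) < n.

open import Defs
open import Algebra.Bundles using (CommutativeRing; CommutativeMonoid; Semiring)
open import Data.Empty using (⊥-elim)
open import Data.Fin using (toℕ)
open import Data.Integer as ℤ using ()
import Data.Integer.Properties as ℤ
import Data.Integer.Divisibility.Signed as ℤ
open import Data.List using (List; []; _∷_; _++_; _∷ʳ_; map; reverse; concatMap; applyUpTo; upTo; length)
import Data.List.Properties as List
open import Data.List.Membership.Propositional using (_∈_)
open import Data.List.Membership.Propositional.Properties
  using (∈-map⁺; ∈-++⁺ˡ; ∈-++⁺ʳ; ∈-concat⁺′; ∈-upTo⁺)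
open import Data.List.Relation.Unary.Any using (here; there)
open import Data.Maybe using (just; nothing; maybe)
import Data.Maybe as Maybe
import Data.Maybe.Properties as Maybe
open import Data.Nat as ℕ using (ℕ; zero; suc; _∸_; _<_; _≤_; z≤n; s≤s)
import Data.Nat.Properties as ℕ
import Data.Nat.ListAction as ℕ
open import Data.Nat.Combinatorics using (_C_; nCk+nC[k+1]≡[n+1]C[k+1])
open import Data.Nat.Coprimality as Coprime using (Coprime; coprime-divisor)
open import Data.Nat.Divisibility as ℕ using (_∣_)
open import Data.Nat.Primality using (Prime; euclidsLemma; prime⇒nonZero; prime⇒irreducible; ¬prime[1])
open import Data.Product using (_,_)
open import Data.Rational as ℚ using (ℚ; mkℚ; 0ℚ; 1ℚ; _+_; _*_; _-_; -_)
import Data.Rational.Properties as ℚ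
open import Data.Rational.Solver using (module +-*-Solver)
open import Data.Rational.Unnormalised as ℚᵘ using (ℚᵘ; mkℚᵘ; *≡*)
import Data.Rational.Unnormalised.Properties as ℚᵘ
open import Data.Sum using (inj₁; inj₂)
open import Function using (_∘_)
open import Relation.Binary.PropositionalEquality
open import Relation.Nullary using (¬_)

open ≡-Reasoning
open +-*-Solver
open CommutativeRing ℚ.+-*-commutativeRing using (semiring; commutativeSemiring)
open Semiring semiring using (rawSemiring)
open import Algebra.Definitions.RawSemiring rawSemiring using (_^_)
open import Algebra.Properties.Semiring.Exp semiring using (^-homo-*)
open import Algebra.Properties.CommutativeSemiring.Exp commutativeSemiring using (^-distrib-*)
open import Algebra.Properties.Semiring.Sum semiring
  using (sum; sum-replicate-zero; ∑-distrib-+; ∑-comm; *-distribˡ-sum)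
open import Algebra.Properties.CommutativeSemigroup
  (CommutativeMonoid.commutativeSemigroup ℚ.+-0-commutativeMonoid) using (interchange)

ℕtoℚ≃ : ∀ n → ℚ.toℚᵘ (ℕtoℚ n) ℚᵘ.≃ mkℚᵘ (ℤ.+ n) 0
ℕtoℚ≃ n = ℚ.toℚᵘ-fromℚᵘ (mkℚᵘ (ℤ.+ n) 0)

ℕtoℚ-homo-+ : ∀ m n → ℕtoℚ (m ℕ.+ n) ≡ ℕtoℚ m + ℕtoℚ n
ℕtoℚ-homo-+ m n = ℚ.toℚᵘ-injective (ℚᵘ.≃-trans (ℕtoℚ≃ (m ℕ.+ n))
  (ℚᵘ.≃-sym (ℚᵘ.≃-trans (ℚ.toℚᵘ-homo-+ (ℕtoℚ m) (ℕtoℚ n))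
    (ℚᵘ.≃-trans (ℚᵘ.+-cong (ℕtoℚ≃ m) (ℕtoℚ≃ n)) (*≡* cross)))))
  where
  cross : (ℤ.+ m ℤ.* ℤ.+ 1 ℤ.+ ℤ.+ n ℤ.* ℤ.+ 1) ℤ.* ℤ.+ 1 ≡ ℤ.+ (m ℕ.+ n) ℤ.* ℤ.+ 1
  cross rewrite ℤ.*-identityʳ (ℤ.+ m) | ℤ.*-identityʳ (ℤ.+ n) | ℤ.*-identityʳ (ℤ.+ m ℤ.+ ℤ.+ n)
    = sym (ℤ.pos-+ m n)

ℕtoℚ-homo-* : ∀ m n → ℕtoℚ (m ℕ.* n) ≡ ℕtoℚ m * ℕtoℚ n
ℕtoℚ-homo-* m n = ℚ.toℚᵘ-injective (ℚᵘ.≃-trans (ℕtoℚ≃ (m ℕ.* n))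
  (ℚᵘ.≃-sym (ℚᵘ.≃-trans (ℚ.toℚᵘ-homo-* (ℕtoℚ m) (ℕtoℚ n))
    (ℚᵘ.≃-trans (ℚᵘ.*-cong (ℕtoℚ≃ m) (ℕtoℚ≃ n)) (*≡* cross)))))
  where
  cross : (ℤ.+ m ℤ.* ℤ.+ n) ℤ.* ℤ.+ 1 ≡ ℤ.+ (m ℕ.* n) ℤ.* ℤ.+ 1
  cross rewrite ℤ.*-identityʳ (ℤ.+ m ℤ.* ℤ.+ n) | ℤ.*-identityʳ (ℤ.+ (m ℕ.* n)) = sym (ℤ.pos-* m n)

ℕtoℚ-homo-^ : ∀ m n → ℕtoℚ (m ℕ.^ n) ≡ ℕtoℚ m ^ n
ℕtoℚ-homo-^ m zero    = refl
ℕtoℚ-homo-^ m (suc n) = trans (ℕtoℚ-homo-* m (m ℕ.^ n)) (cong (ℕtoℚ m *_) (ℕtoℚ-homo-^ m n))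

ℕtoℚ-*-inverse : ∀ n → ℕtoℚ (suc n) * (ℤ.+ 1 ℚ./ suc n) ≡ 1ℚ
ℕtoℚ-*-inverse n = ℚ.toℚᵘ-injective (ℚᵘ.≃-trans (ℚ.toℚᵘ-homo-* (ℕtoℚ (suc n)) (ℤ.+ 1 ℚ./ suc n))
  (ℚᵘ.≃-trans (ℚᵘ.*-cong (ℕtoℚ≃ (suc n)) (ℚ.toℚᵘ-fromℚᵘ (mkℚᵘ (ℤ.+ 1) n))) (*≡* cross)))
  where
  cross : (ℤ.+ suc n ℤ.* ℤ.+ 1) ℤ.* ℤ.+ 1 ≡ ℤ.+ 1 ℤ.* ℤ.+ (1 ℕ.* suc n)
  cross rewrite ℤ.*-identityʳ (ℤ.+ suc n ℤ.* ℤ.+ 1) | ℤ.*-identityʳ (ℤ.+ suc n)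
              | ℤ.*-identityˡ (ℤ.+ (1 ℕ.* suc n)) | ℕ.*-identityˡ (suc n) = refl

invPow≡^ : ∀ m n → invPow m n ≡ (ℤ.+ 1 ℚ./ suc m) ^ n
invPow≡^ m zero    = refl
invPow≡^ m (suc n) = cong ((ℤ.+ 1 ℚ./ suc m) *_) (invPow≡^ m n)

-‿^ : ∀ x n → (- x) ^ n ≡ sign n * x ^ n
-‿^ x zero          = sym (ℚ.*-identityˡ 1ℚ)
-‿^ x (suc zero)    = solve 1 (λ x → :- x :* con 1ℚ := :- con 1ℚ :* (x :* con 1ℚ)) refl x
-‿^ x (suc (suc n)) = trans (cong (λ y → - x * (- x * y)) (-‿^ x n))
  (solve 3 (λ x s y → :- x :* (:- x :* (s :* y)) := s :* (x :* (x :* y))) refl x (sign n) (x ^ n))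

∑< : ℕ → (ℕ → ℚ) → ℚ
∑< zero    f = 0ℚ
∑< (suc K) f = f 0 + ∑< K (f ∘ suc)

∑<≡sum : ∀ K f → ∑< K f ≡ sum {K} (f ∘ toℕ)
∑<≡sum zero    f = refl
∑<≡sum (suc K) f = cong (f 0 +_) (∑<≡sum K (f ∘ suc))

∑<-cong : ∀ K {f g} → (∀ i → i < K → f i ≡ g i) → ∑< K f ≡ ∑< K g
∑<-cong zero    f≡g = refl
∑<-cong (suc K) f≡g = cong₂ _+_ (f≡g 0 (s≤s z≤n)) (∑<-cong K (λ i i<K → f≡g (suc i) (s≤s i<K)))

∑<-zero : ∀ K → ∑< K (λ _ → 0ℚ) ≡ 0ℚ
∑<-zero K = trans (∑<≡sum K _) (sum-replicate-zero K)

∑<-distrib-+ : ∀ K f g → ∑< K (λ i → f i + g i) ≡ ∑< K f + ∑< K g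
∑<-distrib-+ K f g = begin
  ∑< K (λ i → f i + g i)               ≡⟨ ∑<≡sum K _ ⟩
  sum {K} (λ i → f (toℕ i) + g (toℕ i)) ≡⟨ ∑-distrib-+ {K} (f ∘ toℕ) (g ∘ toℕ) ⟩
  sum {K} (f ∘ toℕ) + sum {K} (g ∘ toℕ) ≡⟨ cong₂ _+_ (∑<≡sum K f) (∑<≡sum K g) ⟨
  ∑< K f + ∑< K g                      ∎

*-distribˡ-∑< : ∀ K c f → c * ∑< K f ≡ ∑< K (λ i → c * f i)
*-distribˡ-∑< K c f = begin
  c * ∑< K f                       ≡⟨ cong (c *_) (∑<≡sum K f) ⟩
  c * sum {K} (f ∘ toℕ)            ≡⟨ *-distribˡ-sum {K} c (f ∘ toℕ) ⟩
  sum {K} (λ i → c * f (toℕ i))    ≡⟨ ∑<≡sum K _ ⟨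
  ∑< K (λ i → c * f i)             ∎

∑<-comm : ∀ K L (f : ℕ → ℕ → ℚ) → ∑< K (λ i → ∑< L (f i)) ≡ ∑< L (λ j → ∑< K (λ i → f i j))
∑<-comm K L f = begin
  ∑< K (λ i → ∑< L (f i))                                 ≡⟨ ∑<-cong K (λ i _ → ∑<≡sum L (f i)) ⟩
  ∑< K (λ i → sum {L} (λ j → f i (toℕ j)))                ≡⟨ ∑<≡sum K _ ⟩
  sum {K} (λ i → sum {L} (λ j → f (toℕ i) (toℕ j)))       ≡⟨ ∑-comm {K} {L} (λ i j → f (toℕ i) (toℕ j)) ⟩
  sum {L} (λ j → sum {K} (λ i → f (toℕ i) (toℕ j)))       ≡⟨ ∑<≡sum L _ ⟨
  ∑< L (λ j → sum {K} (λ i → f (toℕ i) j))                ≡⟨ ∑<-cong L (λ j _ → ∑<≡sum K (λ i → f i j)) ⟨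
  ∑< L (λ j → ∑< K (λ i → f i j))                         ∎

∑<-extend : ∀ {K L} f → K ≤ L → (∀ i → K ≤ i → f i ≡ 0ℚ) → ∑< L f ≡ ∑< K f
∑<-extend {zero}  {L}     f _         f≡0 = trans (∑<-cong L (λ i _ → f≡0 i z≤n)) (∑<-zero L)
∑<-extend {suc K} {suc L} f (s≤s K≤L) f≡0 =
  cong (f 0 +_) (∑<-extend (f ∘ suc) K≤L (λ i K≤i → f≡0 (suc i) (s≤s K≤i)))

-- the truncation at K of the expansion of (u/(1-u))^(e+1)
binomialSeries : ℚ → ℕ → ℕ → ℚ
binomialSeries u e K = ∑< K (λ i → ℕtoℚ (i C e) * u ^ suc i)

binomialSeries-0-suc : ∀ u K → binomialSeries u 0 (suc K) ≡ u * (1ℚ + binomialSeries u 0 K)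
binomialSeries-0-suc u K = begin
  1ℚ * (u * 1ℚ) + ∑< K (λ i → 1ℚ * (u * u ^ suc i))
    ≡⟨ cong (1ℚ * (u * 1ℚ) +_) (∑<-cong K (λ i _ → solve 2 (λ u x → con 1ℚ :* (u :* x) := u :* (con 1ℚ :* x)) refl u (u ^ suc i))) ⟩
  1ℚ * (u * 1ℚ) + ∑< K (λ i → u * (1ℚ * u ^ suc i))
    ≡⟨ cong (1ℚ * (u * 1ℚ) +_) (*-distribˡ-∑< K u (λ i → 1ℚ * u ^ suc i)) ⟨
  1ℚ * (u * 1ℚ) + u * binomialSeries u 0 K
    ≡⟨ solve 2 (λ u b → con 1ℚ :* (u :* con 1ℚ) :+ u :* b := u :* (con 1ℚ :+ b)) refl u (binomialSeries u 0 K) ⟩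
  u * (1ℚ + binomialSeries u 0 K) ∎

binomialSeries-suc-suc : ∀ u e K →
  binomialSeries u (suc e) (suc K) ≡ u * (binomialSeries u e K + binomialSeries u (suc e) K)
binomialSeries-suc-suc u e K = begin
  0ℚ * (u * 1ℚ) + ∑< K (λ i → ℕtoℚ (suc i C suc e) * (u * u ^ suc i))
    ≡⟨ trans (cong (_+ ∑< K (λ i → ℕtoℚ (suc i C suc e) * (u * u ^ suc i))) (ℚ.*-zeroˡ (u * 1ℚ))) (ℚ.+-identityˡ _) ⟩
  ∑< K (λ i → ℕtoℚ (suc i C suc e) * (u * u ^ suc i))
    ≡⟨ ∑<-cong K (λ i _ → pascal i) ⟩
  ∑< K (λ i → u * (ℕtoℚ (i C e) * u ^ suc i) + u * (ℕtoℚ (i C suc e) * u ^ suc i))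
    ≡⟨ ∑<-distrib-+ K _ _ ⟩
  ∑< K (λ i → u * (ℕtoℚ (i C e) * u ^ suc i)) + ∑< K (λ i → u * (ℕtoℚ (i C suc e) * u ^ suc i))
    ≡⟨ cong₂ _+_ (*-distribˡ-∑< K u _) (*-distribˡ-∑< K u _) ⟨
  u * binomialSeries u e K + u * binomialSeries u (suc e) K
    ≡⟨ ℚ.*-distribˡ-+ u _ _ ⟨
  u * (binomialSeries u e K + binomialSeries u (suc e) K) ∎
  where
  pascal : ∀ i → ℕtoℚ (suc i C suc e) * (u * u ^ suc i) ≡ u * (ℕtoℚ (i C e) * u ^ suc i) + u * (ℕtoℚ (i C suc e) * u ^ suc i)
  pascal i = begin
    ℕtoℚ (suc i C suc e) * (u * u ^ suc i)
      ≡⟨ cong (λ n → ℕtoℚ n * (u * u ^ suc i)) (nCk+nC[k+1]≡[n+1]C[k+1] i e) ⟨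
    ℕtoℚ (i C e ℕ.+ i C suc e) * (u * u ^ suc i)
      ≡⟨ cong (_* (u * u ^ suc i)) (ℕtoℚ-homo-+ (i C e) (i C suc e)) ⟩
    (ℕtoℚ (i C e) + ℕtoℚ (i C suc e)) * (u * u ^ suc i)
      ≡⟨ solve 4 (λ a b u x → (a :+ b) :* (u :* x) := u :* (a :* x) :+ u :* (b :* x)) refl (ℕtoℚ (i C e)) (ℕtoℚ (i C suc e)) u (u ^ suc i) ⟩
    u * (ℕtoℚ (i C e) * u ^ suc i) + u * (ℕtoℚ (i C suc e) * u ^ suc i) ∎

-- Sums over compositions

weight-++ : ∀ s t → weight (s ++ t) ≡ weight s ℕ.+ weight t
weight-++ []      t = refl
weight-++ (a ∷ s) t = trans (cong (val a ℕ.+_) (weight-++ s t)) (sym (ℕ.+-assoc (val a) (weight s) (weight t)))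

weight-reverse : ∀ s → weight (reverse s) ≡ weight s
weight-reverse []      = refl
weight-reverse (a ∷ s) = begin
  weight (reverse (a ∷ s))              ≡⟨ cong weight (List.unfold-reverse a s) ⟩
  weight (reverse s ++ a ∷ [])          ≡⟨ weight-++ (reverse s) (a ∷ []) ⟩
  weight (reverse s) ℕ.+ (val a ℕ.+ 0)  ≡⟨ cong₂ ℕ._+_ (weight-reverse s) (ℕ.+-identityʳ (val a)) ⟩
  weight s ℕ.+ val a                    ≡⟨ ℕ.+-comm (weight s) (val a) ⟩
  weight (a ∷ s)                        ∎

-- ∑Comp w k F is the sum of F (t with k added to its first part) over the compositions t
-- of weight w, the empty composition contributing only when k = 0.
∑Comp : ℕ → ℕ → (Comp → ℚ) → ℚ
∑Comp zero    zero    F = F []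
∑Comp zero    (suc k) F = 0ℚ
∑Comp (suc w) k       F = ∑Comp w (suc k) F + ∑Comp w 0 (λ t → F ((1+ k) ∷ t))

weight-∷ : ∀ w k t → weight t ≡ w ℕ.+ 0 → weight ((1+ k) ∷ t) ≡ suc w ℕ.+ k
weight-∷ w k t wt = cong suc (begin
  k ℕ.+ weight t    ≡⟨ cong (k ℕ.+_) (trans wt (ℕ.+-identityʳ w)) ⟩
  k ℕ.+ w           ≡⟨ ℕ.+-comm k w ⟩
  w ℕ.+ k           ∎)

∑Comp-cong : ∀ w k {F G} → (∀ t → weight t ≡ w ℕ.+ k → F t ≡ G t) → ∑Comp w k F ≡ ∑Comp w k G
∑Comp-cong zero    zero    F≡G = F≡G [] refl
∑Comp-cong zero    (suc k) F≡G = refl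
∑Comp-cong (suc w) k       F≡G = cong₂ _+_
  (∑Comp-cong w (suc k) (λ t wt → F≡G t (trans wt (ℕ.+-suc w k))))
  (∑Comp-cong w 0 (λ t wt → F≡G ((1+ k) ∷ t) (weight-∷ w k t wt)))

∑Comp-zero : ∀ w k → ∑Comp w k (λ _ → 0ℚ) ≡ 0ℚ
∑Comp-zero zero    zero    = refl
∑Comp-zero zero    (suc k) = refl
∑Comp-zero (suc w) k       = cong₂ _+_ (∑Comp-zero w (suc k)) (∑Comp-zero w 0)

∑Comp-distrib-+ : ∀ w k F G → ∑Comp w k (λ t → F t + G t) ≡ ∑Comp w k F + ∑Comp w k G
∑Comp-distrib-+ zero    zero    F G = refl
∑Comp-distrib-+ zero    (suc k) F G = refl
∑Comp-distrib-+ (suc w) k       F G = trans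
  (cong₂ _+_ (∑Comp-distrib-+ w (suc k) F G) (∑Comp-distrib-+ w 0 _ _))
  (interchange (∑Comp w (suc k) F) (∑Comp w (suc k) G) _ _)

*-distribˡ-∑Comp : ∀ w k c F → c * ∑Comp w k F ≡ ∑Comp w k (λ t → c * F t)
*-distribˡ-∑Comp zero    zero    c F = refl
*-distribˡ-∑Comp zero    (suc k) c F = ℚ.*-zeroʳ c
*-distribˡ-∑Comp (suc w) k       c F = trans (ℚ.*-distribˡ-+ c _ _)
  (cong₂ _+_ (*-distribˡ-∑Comp w (suc k) c F) (*-distribˡ-∑Comp w 0 c _))

∑Comp-∑< : ∀ w k K (f : ℕ → Comp → ℚ) → ∑Comp w k (λ t → ∑< K (λ i → f i t)) ≡ ∑< K (λ i → ∑Comp w k (f i))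
∑Comp-∑< w k zero    f = ∑Comp-zero w k
∑Comp-∑< w k (suc K) f = trans (∑Comp-distrib-+ w k _ _) (cong (∑Comp w k (f 0) +_) (∑Comp-∑< w k K (f ∘ suc)))

∑Comp-comm : ∀ w k v l (f : Comp → Comp → ℚ) →
  ∑Comp w k (λ t → ∑Comp v l (λ s → f s t)) ≡ ∑Comp v l (λ s → ∑Comp w k (f s))
∑Comp-comm zero    zero    v l f = refl
∑Comp-comm zero    (suc k) v l f = sym (∑Comp-zero v l)
∑Comp-comm (suc w) k       v l f = trans
  (cong₂ _+_ (∑Comp-comm w (suc k) v l f) (∑Comp-comm w 0 v l _))
  (sym (∑Comp-distrib-+ v l _ _))

∑Comp< : ℕ → (Comp → ℚ) → ℚ
∑Comp< K F = ∑< K (λ w → ∑Comp w 0 F)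

∑Comp<-cong : ∀ K {F G} → (∀ t → weight t < K → F t ≡ G t) → ∑Comp< K F ≡ ∑Comp< K G
∑Comp<-cong K F≡G = ∑<-cong K (λ w w<K → ∑Comp-cong w 0
  (λ t wt → F≡G t (subst (_< K) (sym (trans wt (ℕ.+-identityʳ w))) w<K)))

∑Comp<-zero : ∀ K → ∑Comp< K (λ _ → 0ℚ) ≡ 0ℚ
∑Comp<-zero K = trans (∑<-cong K (λ w _ → ∑Comp-zero w 0)) (∑<-zero K)

∑Comp<-distrib-+ : ∀ K F G → ∑Comp< K (λ t → F t + G t) ≡ ∑Comp< K F + ∑Comp< K G
∑Comp<-distrib-+ K F G = trans (∑<-cong K (λ w _ → ∑Comp-distrib-+ w 0 F G)) (∑<-distrib-+ K (λ w → ∑Comp w 0 F) (λ w → ∑Comp w 0 G))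

*-distribˡ-∑Comp< : ∀ K c F → c * ∑Comp< K F ≡ ∑Comp< K (λ t → c * F t)
*-distribˡ-∑Comp< K c F = trans (*-distribˡ-∑< K c (λ w → ∑Comp w 0 F)) (∑<-cong K (λ w _ → *-distribˡ-∑Comp w 0 c F))

∑Comp<-comm : ∀ K L (f : Comp → Comp → ℚ) →
  ∑Comp< K (λ t → ∑Comp< L (λ s → f s t)) ≡ ∑Comp< L (λ s → ∑Comp< K (f s))
∑Comp<-comm K L f = begin
  ∑< K (λ w → ∑Comp w 0 (λ t → ∑< L (λ v → ∑Comp v 0 (λ s → f s t))))
    ≡⟨ ∑<-cong K (λ w _ → ∑Comp-∑< w 0 L (λ v t → ∑Comp v 0 (λ s → f s t))) ⟩
  ∑< K (λ w → ∑< L (λ v → ∑Comp w 0 (λ t → ∑Comp v 0 (λ s → f s t))))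
    ≡⟨ ∑<-comm K L (λ w v → ∑Comp w 0 (λ t → ∑Comp v 0 (λ s → f s t))) ⟩
  ∑< L (λ v → ∑< K (λ w → ∑Comp w 0 (λ t → ∑Comp v 0 (λ s → f s t))))
    ≡⟨ ∑<-cong L (λ v _ → ∑<-cong K (λ w _ → ∑Comp-comm w 0 v 0 f)) ⟩
  ∑< L (λ v → ∑< K (λ w → ∑Comp v 0 (λ s → ∑Comp w 0 (f s))))
    ≡⟨ ∑<-cong L (λ v _ → ∑Comp-∑< v 0 K (λ w s → ∑Comp w 0 (f s))) ⟨
  ∑< L (λ v → ∑Comp v 0 (λ s → ∑< K (λ w → ∑Comp w 0 (f s))))
    ∎

∑Comp<-extend : ∀ {K L} F → K ≤ L → (∀ t → K ≤ weight t → F t ≡ 0ℚ) → ∑Comp< L F ≡ ∑Comp< K F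
∑Comp<-extend {K} F K≤L F≡0 = ∑<-extend (λ w → ∑Comp w 0 F) K≤L (λ w K≤w → trans
  (∑Comp-cong w 0 (λ t wt → F≡0 t (subst (K ≤_) (sym (trans wt (ℕ.+-identityʳ w))) K≤w)))
  (∑Comp-zero w 0))

∑Comp-factor-head : ∀ {F G : Comp → ℚ} (Ψ : ℕ → ℚ) → F [] ≡ 0ℚ → (∀ j t → F ((1+ j) ∷ t) ≡ Ψ j * G t) →
  ∀ K k → ∑< K (λ w → ∑Comp w k F) ≡ ∑< K (λ i → Ψ (k ℕ.+ i) * ∑Comp< (K ∸ suc i) G)
∑Comp-factor-head         Ψ F[]≡0 F≡ΨG zero    k = refl
∑Comp-factor-head {F} {G} Ψ F[]≡0 F≡ΨG (suc K) k = begin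
  ∑Comp 0 k F + ∑< K (λ w → ∑Comp w (suc k) F + ∑Comp w 0 (λ t → F ((1+ k) ∷ t)))
    ≡⟨ cong₂ _+_ (empty-term k) (∑<-distrib-+ K (λ w → ∑Comp w (suc k) F) _) ⟩
  0ℚ + (∑< K (λ w → ∑Comp w (suc k) F) + ∑Comp< K (λ t → F ((1+ k) ∷ t)))
    ≡⟨ ℚ.+-identityˡ _ ⟩
  ∑< K (λ w → ∑Comp w (suc k) F) + ∑Comp< K (λ t → F ((1+ k) ∷ t))
    ≡⟨ cong₂ _+_ (∑Comp-factor-head Ψ F[]≡0 F≡ΨG K (suc k))
                 (trans (∑Comp<-cong K (λ t _ → F≡ΨG k t)) (sym (*-distribˡ-∑Comp< K (Ψ k) G))) ⟩
  ∑< K (λ i → Ψ (suc k ℕ.+ i) * ∑Comp< (K ∸ suc i) G) + Ψ k * ∑Comp< K G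
    ≡⟨ ℚ.+-comm _ (Ψ k * ∑Comp< K G) ⟩
  Ψ k * ∑Comp< K G + ∑< K (λ i → Ψ (suc k ℕ.+ i) * ∑Comp< (K ∸ suc i) G)
    ≡⟨ cong₂ _+_ (cong (λ n → Ψ n * ∑Comp< K G) (ℕ.+-identityʳ k))
                 (∑<-cong K (λ i _ → cong (λ n → Ψ n * ∑Comp< (K ∸ suc i) G) (ℕ.+-suc k i))) ⟨
  Ψ (k ℕ.+ 0) * ∑Comp< K G + ∑< K (λ i → Ψ (k ℕ.+ suc i) * ∑Comp< (K ∸ suc i) G) ∎
  where
  empty-term : ∀ k → ∑Comp 0 k F ≡ 0ℚ
  empty-term zero    = F[]≡0
  empty-term (suc k) = refl

Σℚ-++ : ∀ xs ys → Σℚ (xs ++ ys) ≡ Σℚ xs + Σℚ ys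
Σℚ-++ []       ys = sym (ℚ.+-identityˡ _)
Σℚ-++ (x ∷ xs) ys = trans (cong (x +_) (Σℚ-++ xs ys)) (sym (ℚ.+-assoc x (Σℚ xs) (Σℚ ys)))

Σℚ-concatMap : ∀ {A B : Set} (f : B → ℚ) (g : A → List B) xs →
  Σℚ (map f (concatMap g xs)) ≡ Σℚ (map (λ x → Σℚ (map f (g x))) xs)
Σℚ-concatMap f g []       = refl
Σℚ-concatMap f g (x ∷ xs) = begin
  Σℚ (map f (g x ++ concatMap g xs))              ≡⟨ cong Σℚ (List.map-++ f (g x) (concatMap g xs)) ⟩
  Σℚ (map f (g x) ++ map f (concatMap g xs))      ≡⟨ Σℚ-++ (map f (g x)) _ ⟩
  Σℚ (map f (g x)) + Σℚ (map f (concatMap g xs))  ≡⟨ cong (Σℚ (map f (g x)) +_) (Σℚ-concatMap f g xs) ⟩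
  Σℚ (map f (g x)) + Σℚ (map (λ x → Σℚ (map f (g x))) xs) ∎

Σℚ-map-cong : ∀ {A : Set} {f g : A → ℚ} xs → (∀ x → f x ≡ g x) → Σℚ (map f xs) ≡ Σℚ (map g xs)
Σℚ-map-cong xs f≡g = cong Σℚ (List.map-cong f≡g xs)

Σℚ-applyUpTo : ∀ (f : ℕ → ℚ) (g : ℕ → ℕ) n → Σℚ (map f (applyUpTo g n)) ≡ ∑< n (f ∘ g)
Σℚ-applyUpTo f g zero    = refl
Σℚ-applyUpTo f g (suc n) = cong (f (g 0) +_) (Σℚ-applyUpTo f (g ∘ suc) n)

Σℚ-upTo : ∀ (f : ℕ → ℚ) n → Σℚ (map f (upTo n)) ≡ ∑< n f
Σℚ-upTo f = Σℚ-applyUpTo f (λ i → i)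

shiftHead : ℕ → (Comp → ℚ) → Comp → ℚ
shiftHead k       F ((1+ a) ∷ t) = F ((1+ (a ℕ.+ k)) ∷ t)
shiftHead zero    F []           = F []
shiftHead (suc k) F []           = 0ℚ

Σℚ-compsOfWeight-shiftHead : ∀ w k F → Σℚ (map (shiftHead k F) (compsOfWeight w)) ≡ ∑Comp w k F
Σℚ-compsOfWeight-shiftHead zero    zero    F = ℚ.+-identityʳ (F [])
Σℚ-compsOfWeight-shiftHead zero    (suc k) F = ℚ.+-identityʳ 0ℚ
Σℚ-compsOfWeight-shiftHead (suc w) k       F = begin
  Σℚ (map G (map ((1+ 0) ∷_) cs ++ concatMap incHead cs))
    ≡⟨ cong Σℚ (List.map-++ G (map ((1+ 0) ∷_) cs) (concatMap incHead cs)) ⟩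
  Σℚ (map G (map ((1+ 0) ∷_) cs) ++ map G (concatMap incHead cs))
    ≡⟨ Σℚ-++ (map G (map ((1+ 0) ∷_) cs)) _ ⟩
  Σℚ (map G (map ((1+ 0) ∷_) cs)) + Σℚ (map G (concatMap incHead cs))
    ≡⟨ ℚ.+-comm (Σℚ (map G (map ((1+ 0) ∷_) cs))) _ ⟩
  Σℚ (map G (concatMap incHead cs)) + Σℚ (map G (map ((1+ 0) ∷_) cs))
    ≡⟨ cong₂ _+_ (Σℚ-concatMap G incHead cs) (cong Σℚ (sym (List.map-∘ cs))) ⟩
  Σℚ (map (λ t → Σℚ (map G (incHead t))) cs) + Σℚ (map (G ∘ ((1+ 0) ∷_)) cs)
    ≡⟨ cong₂ _+_ (Σℚ-map-cong cs incHead-shift) (Σℚ-map-cong cs one-shift) ⟩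
  Σℚ (map (shiftHead (suc k) F) cs) + Σℚ (map (shiftHead 0 (λ t → F ((1+ k) ∷ t))) cs)
    ≡⟨ cong₂ _+_ (Σℚ-compsOfWeight-shiftHead w (suc k) F) (Σℚ-compsOfWeight-shiftHead w 0 _) ⟩
  ∑Comp (suc w) k F ∎
  where
  G = shiftHead k F
  cs = compsOfWeight w
  incHead-shift : ∀ t → Σℚ (map G (incHead t)) ≡ shiftHead (suc k) F t
  incHead-shift []           = refl
  incHead-shift ((1+ a) ∷ t) = trans (ℚ.+-identityʳ _) (cong (λ n → F ((1+ n) ∷ t)) (sym (ℕ.+-suc a k)))
  one-shift : ∀ t → G ((1+ 0) ∷ t) ≡ shiftHead 0 (λ t → F ((1+ k) ∷ t)) t
  one-shift []           = refl
  one-shift ((1+ a) ∷ t) = cong (λ n → F ((1+ k) ∷ (1+ n) ∷ t)) (sym (ℕ.+-identityʳ a))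

Σℚ-compsOfWeight : ∀ w F → Σℚ (map F (compsOfWeight w)) ≡ ∑Comp w 0 F
Σℚ-compsOfWeight w F = trans (Σℚ-map-cong (compsOfWeight w) unshifted) (Σℚ-compsOfWeight-shiftHead w 0 F)
  where
  unshifted : ∀ t → F t ≡ shiftHead 0 F t
  unshifted []           = refl
  unshifted ((1+ a) ∷ t) = cong (λ n → F ((1+ n) ∷ t)) (sym (ℕ.+-identityʳ a))

truncSum-as-∑Comp< : ∀ β n p →
  truncSum β n p ≡ ∑Comp< n (λ t → β t * (ℕtoℚ (p ℕ.^ weight t) * H (p ∸ 1) t))
truncSum-as-∑Comp< β n p = begin
  Σℚ (map (λ w → Σℚ (map (summand w) (compsOfWeight w))) (upTo n))
    ≡⟨ Σℚ-upTo (λ w → Σℚ (map (summand w) (compsOfWeight w))) n ⟩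
  ∑< n (λ w → Σℚ (map (summand w) (compsOfWeight w)))
    ≡⟨ ∑<-cong n (λ w _ → trans (Σℚ-compsOfWeight w (summand w)) (∑Comp-cong w 0 (λ t wt → begin
         β t * ℕtoℚ (p ℕ.^ w) * H (p ∸ 1) t           ≡⟨ ℚ.*-assoc (β t) _ _ ⟩
         β t * (ℕtoℚ (p ℕ.^ w) * H (p ∸ 1) t)         ≡⟨ cong (λ v → β t * (ℕtoℚ (p ℕ.^ v) * H (p ∸ 1) t))
                                                           (trans wt (ℕ.+-identityʳ w)) ⟨
         β t * (ℕtoℚ (p ℕ.^ weight t) * H (p ∸ 1) t)  ∎))) ⟩
  ∑Comp< n (λ t → β t * (ℕtoℚ (p ℕ.^ weight t) * H (p ∸ 1) t)) ∎
  where
  summand : ℕ → Comp → ℚ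
  summand w s = β s * ℕtoℚ (p ℕ.^ w) * H (p ∸ 1) s

xs-++-X : ∀ k v → xs k ++ X ∷ v ≡ X ∷ xs k ++ v
xs-++-X zero    v = refl
xs-++-X (suc k) v = cong (X ∷_) (xs-++-X k v)

reverse-xs : ∀ k → reverse (xs k) ≡ xs k
reverse-xs zero    = refl
reverse-xs (suc k) = begin
  reverse (X ∷ xs k)    ≡⟨ List.unfold-reverse X (xs k) ⟩
  reverse (xs k) ∷ʳ X   ≡⟨ cong (_∷ʳ X) (reverse-xs k) ⟩
  xs k ++ X ∷ []        ≡⟨ xs-++-X k [] ⟩
  X ∷ xs k ++ []        ≡⟨ cong (X ∷_) (List.++-identityʳ (xs k)) ⟩
  X ∷ xs k              ∎

z-++ : ∀ s t → z (s ++ t) ≡ z s ++ z t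
z-++ []            t = refl
z-++ ((1+ k) ∷ s) t = trans (cong (λ w → xs k ++ Y ∷ w) (z-++ s t)) (sym (List.++-assoc (xs k) (Y ∷ z s) (z t)))

length-z : ∀ t → length (z t) ≡ weight t
length-z []           = refl
length-z ((1+ k) ∷ t) = begin
  length (xs k ++ Y ∷ z t)              ≡⟨ List.length-++ (xs k) ⟩
  length (xs k) ℕ.+ suc (length (z t))  ≡⟨ cong₂ (λ a b → a ℕ.+ suc b) (length-xs k) (length-z t) ⟩
  k ℕ.+ suc (weight t)                  ≡⟨ ℕ.+-suc k (weight t) ⟩
  suc (k ℕ.+ weight t)                  ∎
  where
  length-xs : ∀ k → length (xs k) ≡ k
  length-xs zero    = refl
  length-xs (suc k) = cong suc (length-xs k)

Y∷z-reverse : ∀ t → Y ∷ z (reverse t) ≡ reverse (z t) ++ Y ∷ []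
Y∷z-reverse []            = refl
Y∷z-reverse ((1+ k) ∷ t) = begin
  Y ∷ z (reverse ((1+ k) ∷ t))                     ≡⟨ cong (λ w → Y ∷ z w) (List.unfold-reverse (1+ k) t) ⟩
  Y ∷ z (reverse t ++ (1+ k) ∷ [])                 ≡⟨ cong (Y ∷_) (z-++ (reverse t) ((1+ k) ∷ [])) ⟩
  (Y ∷ z (reverse t)) ++ (xs k ++ Y ∷ [])          ≡⟨ cong (_++ (xs k ++ Y ∷ [])) (Y∷z-reverse t) ⟩
  (reverse (z t) ++ Y ∷ []) ++ (xs k ++ Y ∷ [])    ≡⟨ List.++-assoc (reverse (z t) ++ Y ∷ []) (xs k) (Y ∷ []) ⟨
  ((reverse (z t) ++ Y ∷ []) ++ xs k) ++ Y ∷ []    ≡⟨ cong₂ (λ a b → (a ++ b) ++ Y ∷ []) (List.unfold-reverse Y (z t)) (reverse-xs k) ⟨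
  (reverse (Y ∷ z t) ++ reverse (xs k)) ++ Y ∷ []  ≡⟨ cong (_++ Y ∷ []) (List.reverse-++ (xs k) (Y ∷ z t)) ⟨
  reverse (xs k ++ Y ∷ z t) ++ Y ∷ []              ∎

decode-X : ∀ k u → decode k (X ∷ u) ≡ decode (suc k) u
decode-X zero    u = refl
decode-X (suc k) u = refl

decode-Y : ∀ k u → decode k (Y ∷ u) ≡ Maybe.map ((1+ k) ∷_) (decode 0 u)
decode-Y zero    u = refl
decode-Y (suc k) u = refl

decode-xs-++-Y∷z : ∀ k j t → decode k (xs j ++ Y ∷ z t) ≡ just ((1+ (j ℕ.+ k)) ∷ t)
decode-xs-++-Y∷z k zero    []            = decode-Y k []
decode-xs-++-Y∷z k zero    ((1+ m) ∷ t) = trans (decode-Y k _)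
  (cong (Maybe.map ((1+ k) ∷_)) (trans (decode-xs-++-Y∷z 0 m t) (cong (λ n → just ((1+ n) ∷ t)) (ℕ.+-identityʳ m))))
decode-xs-++-Y∷z k (suc j) t = trans (decode-X k _)
  (trans (decode-xs-++-Y∷z (suc k) j t) (cong (λ n → just ((1+ n) ∷ t)) (ℕ.+-suc j k)))

decode-z : ∀ t → decode 0 (z t) ≡ just t
decode-z []            = refl
decode-z ((1+ j) ∷ t) = trans (decode-xs-++-Y∷z 0 j t) (cong (λ n → just ((1+ n) ∷ t)) (ℕ.+-identityʳ j))

z-injective : ∀ {s t} → z s ≡ z t → s ≡ t
z-injective {s} {t} zs≡zt = Maybe.just-injective (begin
  just s          ≡⟨ decode-z s ⟨
  decode 0 (z s)  ≡⟨ cong (decode 0) zs≡zt ⟩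
  decode 0 (z t)  ≡⟨ decode-z t ⟩
  just t          ∎)

decode-sound : ∀ k v {s} → decode k v ≡ just s → z s ≡ xs k ++ v
decode-sound zero    []      refl = refl
decode-sound (suc k) []      ()
decode-sound k       (X ∷ v) eq   = trans (decode-sound (suc k) v (trans (sym (decode-X k v)) eq)) (sym (xs-++-X k v))
decode-sound k       (Y ∷ v) eq   with decode 0 v in eq′ | trans (sym (decode-Y k v)) eq
... | just s′ | refl = cong (λ w → xs k ++ Y ∷ w) (decode-sound 0 v eq′)

compOfWord : ℕ → Word → Comp
compOfWord k []      = (1+ k) ∷ []
compOfWord k (X ∷ u) = compOfWord (suc k) u
compOfWord k (Y ∷ u) = (1+ k) ∷ compOfWord 0 u

z-compOfWord : ∀ k u → z (compOfWord k u) ≡ xs k ++ u ++ Y ∷ []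
z-compOfWord k []      = refl
z-compOfWord k (X ∷ u) = trans (z-compOfWord (suc k) u) (sym (xs-++-X k (u ++ Y ∷ [])))
z-compOfWord k (Y ∷ u) = cong (λ w → xs k ++ Y ∷ w) (z-compOfWord 0 u)

compOfWord-reverse : ∀ u → compOfWord 0 (reverse u) ≡ reverse (compOfWord 0 u)
compOfWord-reverse u = z-injective (List.∷-injectiveʳ (begin
  Y ∷ z (compOfWord 0 (reverse u))        ≡⟨ cong (Y ∷_) (z-compOfWord 0 (reverse u)) ⟩
  Y ∷ reverse u ++ Y ∷ []                 ≡⟨ cong (_++ Y ∷ []) (List.reverse-++ u (Y ∷ [])) ⟨
  reverse (u ++ Y ∷ []) ++ Y ∷ []         ≡⟨ cong (λ w → reverse w ++ Y ∷ []) (z-compOfWord 0 u) ⟨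
  reverse (z (compOfWord 0 u)) ++ Y ∷ []  ≡⟨ Y∷z-reverse (compOfWord 0 u) ⟨
  Y ∷ z (reverse (compOfWord 0 u))        ∎))

∑Word : ℕ → (Word → ℚ) → ℚ
∑Word zero    f = f []
∑Word (suc L) f = ∑Word L (λ u → f (X ∷ u) + f (Y ∷ u))

∑Word-cong : ∀ L {f g} → (∀ u → f u ≡ g u) → ∑Word L f ≡ ∑Word L g
∑Word-cong zero    f≡g = f≡g []
∑Word-cong (suc L) f≡g = ∑Word-cong L (λ u → cong₂ _+_ (f≡g _) (f≡g _))

∑Word-distrib-+ : ∀ L f g → ∑Word L (λ u → f u + g u) ≡ ∑Word L f + ∑Word L g
∑Word-distrib-+ zero    f g = refl
∑Word-distrib-+ (suc L) f g = trans
  (∑Word-cong L (λ u → interchange (f (X ∷ u)) (g (X ∷ u)) (f (Y ∷ u)) (g (Y ∷ u))))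
  (∑Word-distrib-+ L _ _)

Σℚ-wordsOfLength : ∀ L f → Σℚ (map f (wordsOfLength L)) ≡ ∑Word L f
Σℚ-wordsOfLength zero    f = ℚ.+-identityʳ (f [])
Σℚ-wordsOfLength (suc L) f = begin
  Σℚ (map f (concatMap (λ w → (X ∷ w) ∷ (Y ∷ w) ∷ []) (wordsOfLength L)))
    ≡⟨ Σℚ-concatMap f (λ w → (X ∷ w) ∷ (Y ∷ w) ∷ []) (wordsOfLength L) ⟩
  Σℚ (map (λ w → f (X ∷ w) + (f (Y ∷ w) + 0ℚ)) (wordsOfLength L))
    ≡⟨ Σℚ-map-cong (wordsOfLength L) (λ w → cong (f (X ∷ w) +_) (ℚ.+-identityʳ (f (Y ∷ w)))) ⟩
  Σℚ (map (λ w → f (X ∷ w) + f (Y ∷ w)) (wordsOfLength L))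
    ≡⟨ Σℚ-wordsOfLength L _ ⟩
  ∑Word (suc L) f ∎

∑Word-∷ʳ : ∀ L f → ∑Word (suc L) f ≡ ∑Word L (λ u → f (u ∷ʳ X) + f (u ∷ʳ Y))
∑Word-∷ʳ zero    f = refl
∑Word-∷ʳ (suc L) f = trans (∑Word-∷ʳ L (λ u → f (X ∷ u) + f (Y ∷ u)))
  (∑Word-cong L (λ u → interchange (f (X ∷ (u ∷ʳ X))) (f (Y ∷ (u ∷ʳ X))) (f (X ∷ (u ∷ʳ Y))) (f (Y ∷ (u ∷ʳ Y)))))

∑Word-reverse : ∀ L f → ∑Word L (f ∘ reverse) ≡ ∑Word L f
∑Word-reverse zero    f = refl
∑Word-reverse (suc L) f = begin
  ∑Word L (λ u → f (reverse (X ∷ u)) + f (reverse (Y ∷ u)))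
    ≡⟨ ∑Word-cong L (λ u → cong₂ _+_ (cong f (List.unfold-reverse X u)) (cong f (List.unfold-reverse Y u))) ⟩
  ∑Word L (λ u → f (reverse u ∷ʳ X) + f (reverse u ∷ʳ Y))
    ≡⟨ ∑Word-reverse L (λ v → f (v ∷ʳ X) + f (v ∷ʳ Y)) ⟩
  ∑Word L (λ v → f (v ∷ʳ X) + f (v ∷ʳ Y))
    ≡⟨ ∑Word-∷ʳ L f ⟨
  ∑Word (suc L) f ∎

∑Comp-∑Word : ∀ L k F → ∑Comp (suc L) k F ≡ ∑Word L (F ∘ compOfWord k)
∑Comp-∑Word zero    k F = ℚ.+-identityˡ _
∑Comp-∑Word (suc L) k F = trans
  (cong₂ _+_ (∑Comp-∑Word L (suc k) F) (∑Comp-∑Word L 0 (λ t → F ((1+ k) ∷ t))))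
  (sym (∑Word-distrib-+ L _ _))

∑Comp-reverse : ∀ w F → ∑Comp w 0 (F ∘ reverse) ≡ ∑Comp w 0 F
∑Comp-reverse zero    F = refl
∑Comp-reverse (suc L) F = begin
  ∑Comp (suc L) 0 (F ∘ reverse)             ≡⟨ ∑Comp-∑Word L 0 (F ∘ reverse) ⟩
  ∑Word L (F ∘ reverse ∘ compOfWord 0)      ≡⟨ ∑Word-cong L (λ u → cong F (compOfWord-reverse u)) ⟨
  ∑Word L (F ∘ compOfWord 0 ∘ reverse)      ≡⟨ ∑Word-reverse L (F ∘ compOfWord 0) ⟩
  ∑Word L (F ∘ compOfWord 0)                ≡⟨ ∑Comp-∑Word L 0 F ⟨
  ∑Comp (suc L) 0 F                         ∎

∑Comp<-reverse : ∀ K F → ∑Comp< K (F ∘ reverse) ≡ ∑Comp< K F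
∑Comp<-reverse K F = ∑<-cong K (λ w _ → ∑Comp-reverse w F)

∑Word-decode : ∀ L k F → ∑Word L (maybe F 0ℚ ∘ decode k) ≡ ∑Comp L k F
∑Word-decode zero    zero    F = refl
∑Word-decode zero    (suc k) F = refl
∑Word-decode (suc L) k       F = begin
  ∑Word L (λ u → maybe F 0ℚ (decode k (X ∷ u)) + maybe F 0ℚ (decode k (Y ∷ u)))
    ≡⟨ ∑Word-cong L (λ u → cong₂ _+_ (cong (maybe F 0ℚ) (decode-X k u))
                                     (trans (cong (maybe F 0ℚ) (decode-Y k u)) (maybe-map (decode 0 u)))) ⟩
  ∑Word L (λ u → maybe F 0ℚ (decode (suc k) u) + maybe F′ 0ℚ (decode 0 u))
    ≡⟨ ∑Word-distrib-+ L _ _ ⟩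
  ∑Word L (maybe F 0ℚ ∘ decode (suc k)) + ∑Word L (maybe F′ 0ℚ ∘ decode 0)
    ≡⟨ cong₂ _+_ (∑Word-decode L (suc k) F) (∑Word-decode L 0 F′) ⟩
  ∑Comp (suc L) k F ∎
  where
  F′ : Comp → ℚ
  F′ t = F ((1+ k) ∷ t)
  maybe-map : ∀ m → maybe F 0ℚ (Maybe.map ((1+ k) ∷_) m) ≡ maybe F′ 0ℚ m
  maybe-map (just t) = refl
  maybe-map nothing  = refl

-- Coefficients of Φ₁

imgCoef-longer : ∀ v u → length u < length v → imgCoef v u ≡ 0
imgCoef-longer (a ∷ v) []      _         = refl
imgCoef-longer (a ∷ v) (b ∷ u) (s≤s |u|<|v|)
  rewrite imgCoef-longer v u |u|<|v| | imgCoef-longer (a ∷ v) u (ℕ.m<n⇒m<1+n |u|<|v|)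
  = cong₂ ℕ._+_ (ℕ.*-zeroʳ (sameLetter b a)) (ℕ.*-zeroʳ (sameLetter b X))

-- Φ₁(x^m y) = Σⱼ (j choose m) x^j y
imgCoef-xs-++-Y : ∀ m j v u → imgCoef (xs m ++ Y ∷ v) (xs j ++ Y ∷ u) ≡ (j C m) ℕ.* imgCoef v u
imgCoef-xs-++-Y zero    zero    v u = ℕ.+-identityʳ _
imgCoef-xs-++-Y zero    (suc j) v u = trans (ℕ.+-identityʳ _) (imgCoef-xs-++-Y zero j v u)
imgCoef-xs-++-Y (suc m) zero    v u = refl
imgCoef-xs-++-Y (suc m) (suc j) v u = begin
  (imgCoef (xs m ++ Y ∷ v) (xs j ++ Y ∷ u) ℕ.+ 0) ℕ.+ (imgCoef (xs (suc m) ++ Y ∷ v) (xs j ++ Y ∷ u) ℕ.+ 0)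
    ≡⟨ cong₂ ℕ._+_ (trans (ℕ.+-identityʳ _) (imgCoef-xs-++-Y m j v u))
                   (trans (ℕ.+-identityʳ _) (imgCoef-xs-++-Y (suc m) j v u)) ⟩
  (j C m) ℕ.* imgCoef v u ℕ.+ (j C suc m) ℕ.* imgCoef v u
    ≡⟨ ℕ.*-distribʳ-+ (imgCoef v u) (j C m) (j C suc m) ⟨
  (j C m ℕ.+ j C suc m) ℕ.* imgCoef v u
    ≡⟨ cong (ℕ._* imgCoef v u) (nCk+nC[k+1]≡[n+1]C[k+1] j m) ⟩
  (suc j C suc m) ℕ.* imgCoef v u ∎

Φ₁-coef : Comp → Comp → ℚ
Φ₁-coef s t = ℕtoℚ (imgCoef (z s) (z t))

Φ₁-coef-∷-[] : ∀ a s → Φ₁-coef (a ∷ s) [] ≡ 0ℚ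
Φ₁-coef-∷-[] (1+ zero)  s = refl
Φ₁-coef-∷-[] (1+ suc k) s = refl

Φ₁-coef-[]-∷ : ∀ a s → Φ₁-coef [] (a ∷ s) ≡ 0ℚ
Φ₁-coef-[]-∷ (1+ zero)  s = refl
Φ₁-coef-[]-∷ (1+ suc k) s = refl

Φ₁-coef-∷-∷ : ∀ e j s t → Φ₁-coef ((1+ e) ∷ s) ((1+ j) ∷ t) ≡ ℕtoℚ (j C e) * Φ₁-coef s t
Φ₁-coef-∷-∷ e j s t =
  trans (cong ℕtoℚ (imgCoef-xs-++-Y e j (z s) (z t))) (ℕtoℚ-homo-* (j C e) (imgCoef (z s) (z t)))

Σℚ-ι-wordsOfLength : ∀ L α (g : Word → ℚ) →
  Σℚ (map (λ v → ι α v * g v) (wordsOfLength L)) ≡ ∑Comp L 0 (λ s → α s * g (z s))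
Σℚ-ι-wordsOfLength L α g = begin
  Σℚ (map (λ v → ι α v * g v) (wordsOfLength L))   ≡⟨ Σℚ-wordsOfLength L _ ⟩
  ∑Word L (λ v → ι α v * g v)                       ≡⟨ ∑Word-cong L ι-summand ⟩
  ∑Word L (maybe (λ s → α s * g (z s)) 0ℚ ∘ decode 0) ≡⟨ ∑Word-decode L 0 _ ⟩
  ∑Comp L 0 (λ s → α s * g (z s))                   ∎
  where
  ι-summand : ∀ v → ι α v * g v ≡ maybe (λ s → α s * g (z s)) 0ℚ (decode 0 v)
  ι-summand v with decode 0 v in eq
  ... | just s  = cong (λ w → α s * g w) (sym (decode-sound 0 v eq))
  ... | nothing = ℚ.*-zeroˡ (g v)

Φ₁¹-as-∑Comp< : ∀ α K t → weight t < K → Φ₁¹ α t ≡ ∑Comp< K (λ s → α s * Φ₁-coef s t)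
Φ₁¹-as-∑Comp< α K t wt<K = begin
  Σℚ (map f (concatMap wordsOfLength (upTo (suc |zt|))))
    ≡⟨ Σℚ-concatMap f wordsOfLength (upTo (suc |zt|)) ⟩
  Σℚ (map (λ L → Σℚ (map f (wordsOfLength L))) (upTo (suc |zt|)))
    ≡⟨ Σℚ-upTo (λ L → Σℚ (map f (wordsOfLength L))) (suc |zt|) ⟩
  ∑< (suc |zt|) (λ L → Σℚ (map f (wordsOfLength L)))
    ≡⟨ ∑<-cong (suc |zt|) (λ L _ → Σℚ-ι-wordsOfLength L α (λ v → ℕtoℚ (imgCoef v (z t)))) ⟩
  ∑Comp< (suc |zt|) (λ s → α s * Φ₁-coef s t)
    ≡⟨ ∑Comp<-extend _ (subst (λ m → suc m ≤ K) (sym (length-z t)) wt<K) vanishes ⟨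
  ∑Comp< K (λ s → α s * Φ₁-coef s t) ∎
  where
  |zt| = length (z t)
  f : Word → ℚ
  f v = ι α v * ℕtoℚ (imgCoef v (z t))
  vanishes : ∀ s → suc |zt| ≤ weight s → α s * Φ₁-coef s t ≡ 0ℚ
  vanishes s |zt|<ws = trans
    (cong (λ m → α s * ℕtoℚ m) (imgCoef-longer (z s) (z t) (subst (suc |zt| ≤_) (sym (length-z s)) |zt|<ws)))
    (ℚ.*-zeroʳ (α s))

∑Comp<-Φ₁¹ : ∀ α K (A : Comp → ℚ) →
  ∑Comp< K (λ t → Φ₁¹ α t * A t) ≡ ∑Comp< K (λ s → α s * ∑Comp< K (λ t → Φ₁-coef s t * A t))
∑Comp<-Φ₁¹ α K A = begin
  ∑Comp< K (λ t → Φ₁¹ α t * A t)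
    ≡⟨ ∑Comp<-cong K (λ t wt<K → cong (_* A t) (Φ₁¹-as-∑Comp< α K t wt<K)) ⟩
  ∑Comp< K (λ t → ∑Comp< K (λ s → α s * Φ₁-coef s t) * A t)
    ≡⟨ ∑Comp<-cong K (λ t _ → trans (ℚ.*-comm _ (A t)) (*-distribˡ-∑Comp< K (A t) _)) ⟩
  ∑Comp< K (λ t → ∑Comp< K (λ s → A t * (α s * Φ₁-coef s t)))
    ≡⟨ ∑Comp<-comm K K (λ s t → A t * (α s * Φ₁-coef s t)) ⟩
  ∑Comp< K (λ s → ∑Comp< K (λ t → A t * (α s * Φ₁-coef s t)))
    ≡⟨ ∑Comp<-cong K (λ s _ → ∑Comp<-cong K (λ t _ →
         solve 3 (λ a x c → a :* (x :* c) := x :* (c :* a)) refl (A t) (α s) (Φ₁-coef s t))) ⟩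
  ∑Comp< K (λ s → ∑Comp< K (λ t → α s * (Φ₁-coef s t * A t)))
    ≡⟨ ∑Comp<-cong K (λ s _ → *-distribˡ-∑Comp< K (α s) _) ⟨
  ∑Comp< K (λ s → α s * ∑Comp< K (λ t → Φ₁-coef s t * A t)) ∎

∑Comp<-ψ₁ : ∀ α K (A : Comp → ℚ) →
  ∑Comp< K (λ t → ψ₁ α t * A t) ≡ ∑Comp< K (λ s → α s * (sign (weight s) * A (reverse s)))
∑Comp<-ψ₁ α K A = begin
  ∑Comp< K (λ t → ψ₁ α t * A t)
    ≡⟨ ∑Comp<-reverse K (λ t → ψ₁ α t * A t) ⟨
  ∑Comp< K (λ s → sign (weight (reverse s)) * α (reverse (reverse s)) * A (reverse s))
    ≡⟨ ∑Comp<-cong K (λ s _ → cong₂ (λ w s′ → sign w * α s′ * A (reverse s)) (weight-reverse s) (List.reverse-involutive s)) ⟩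
  ∑Comp< K (λ s → sign (weight s) * α s * A (reverse s))
    ≡⟨ ∑Comp<-cong K (λ s _ → solve 3 (λ σ x a → σ :* x :* a := x :* (σ :* a)) refl (sign (weight s)) (α s) (A (reverse s))) ⟩
  ∑Comp< K (λ s → α s * (sign (weight s) * A (reverse s))) ∎

-- Nested sums

-- nestedSum a d (g₁ ∷ ⋯ ∷ gₖ) = Σ_{a + d > m₁ > ⋯ > mₖ ≥ a} g₁ m₁ ⋯ gₖ mₖ
nestedSum : ℕ → ℕ → List (ℕ → ℚ) → ℚ
nestedSum a d       []       = 1ℚ
nestedSum a zero    (g ∷ gs) = 0ℚ
nestedSum a (suc d) (g ∷ gs) = nestedSum a d (g ∷ gs) + g (a ℕ.+ d) * nestedSum a d gs

nestedSum-zero-∷ʳ : ∀ a gs h → nestedSum a 0 (gs ∷ʳ h) ≡ 0ℚ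
nestedSum-zero-∷ʳ a []       h = refl
nestedSum-zero-∷ʳ a (g ∷ gs) h = refl

nestedSum-lowest : ∀ d a gs h →
  nestedSum a (suc d) (gs ∷ʳ h) ≡ nestedSum (suc a) d (gs ∷ʳ h) + h a * nestedSum (suc a) d gs
nestedSum-lowest zero    a []       h = cong (λ m → 0ℚ + h m * 1ℚ) (ℕ.+-identityʳ a)
nestedSum-lowest (suc d) a []       h = begin
  nestedSum a (suc d) (h ∷ []) + h (a ℕ.+ suc d) * 1ℚ
    ≡⟨ cong₂ (λ x m → x + h m * 1ℚ) (nestedSum-lowest d a [] h) (ℕ.+-suc a d) ⟩
  nestedSum (suc a) d (h ∷ []) + h a * 1ℚ + h (suc a ℕ.+ d) * 1ℚ
    ≡⟨ solve 3 (λ x y z → x :+ y :+ z := x :+ z :+ y) refl (nestedSum (suc a) d (h ∷ [])) (h a * 1ℚ) _ ⟩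
  nestedSum (suc a) d (h ∷ []) + h (suc a ℕ.+ d) * 1ℚ + h a * 1ℚ ∎
nestedSum-lowest zero    a (g ∷ gs) h = begin
  0ℚ + g (a ℕ.+ 0) * nestedSum a 0 (gs ∷ʳ h)  ≡⟨ cong (λ x → 0ℚ + g (a ℕ.+ 0) * x) (nestedSum-zero-∷ʳ a gs h) ⟩
  0ℚ + g (a ℕ.+ 0) * 0ℚ                       ≡⟨ solve 2 (λ x y → con 0ℚ :+ x :* con 0ℚ := con 0ℚ :+ y :* con 0ℚ) refl (g (a ℕ.+ 0)) (h a) ⟩
  0ℚ + h a * 0ℚ                               ∎
nestedSum-lowest (suc d) a (g ∷ gs) h = begin
  nestedSum a (suc d) (g ∷ gs ∷ʳ h) + g (a ℕ.+ suc d) * nestedSum a (suc d) (gs ∷ʳ h)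
    ≡⟨ cong₂ (λ x m → x + g m * nestedSum a (suc d) (gs ∷ʳ h)) (nestedSum-lowest d a (g ∷ gs) h) (ℕ.+-suc a d) ⟩
  (S₁ + h a * S₂) + g (suc a ℕ.+ d) * nestedSum a (suc d) (gs ∷ʳ h)
    ≡⟨ cong (λ y → (S₁ + h a * S₂) + g (suc a ℕ.+ d) * y) (nestedSum-lowest d a gs h) ⟩
  (S₁ + h a * S₂) + g (suc a ℕ.+ d) * (S₃ + h a * S₄)
    ≡⟨ solve 6 (λ A B C D ha gm → (A :+ ha :* B) :+ gm :* (C :+ ha :* D) := (A :+ gm :* C) :+ ha :* (B :+ gm :* D))
         refl S₁ S₂ S₃ S₄ (h a) (g (suc a ℕ.+ d)) ⟩
  (S₁ + g (suc a ℕ.+ d) * S₃) + h a * (S₂ + g (suc a ℕ.+ d) * S₄) ∎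
  where
  S₁ = nestedSum (suc a) d (g ∷ gs ∷ʳ h)
  S₂ = nestedSum (suc a) d (g ∷ gs)
  S₃ = nestedSum (suc a) d (gs ∷ʳ h)
  S₄ = nestedSum (suc a) d gs

reflectAt : ℕ → (ℕ → ℚ) → ℕ → ℚ
reflectAt K g m = g (K ∸ suc m)

-- substituting m ↦ K - 1 - m reverses the order of the summation indices
nestedSum-reflect : ∀ d a b K → a ℕ.+ d ℕ.+ b ≡ K → ∀ gs →
  nestedSum a d (map (reflectAt K) gs) ≡ nestedSum b d (reverse gs)
nestedSum-reflect d       a b K _ []       = refl
nestedSum-reflect zero    a b K _ (g ∷ gs) = sym (begin
  nestedSum b 0 (reverse (g ∷ gs))  ≡⟨ cong (nestedSum b 0) (List.unfold-reverse g gs) ⟩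
  nestedSum b 0 (reverse gs ∷ʳ g)   ≡⟨ nestedSum-zero-∷ʳ b (reverse gs) g ⟩
  0ℚ                                ∎)
nestedSum-reflect (suc d) a b K a+d+b≡K (g ∷ gs) = begin
  nestedSum a d (map (reflectAt K) (g ∷ gs)) + g (K ∸ suc (a ℕ.+ d)) * nestedSum a d (map (reflectAt K) gs)
    ≡⟨ cong₂ (λ x m → x + g m * nestedSum a d (map (reflectAt K) gs)) (nestedSum-reflect d a (suc b) K a+d+1+b≡K (g ∷ gs)) index ⟩
  nestedSum (suc b) d (reverse (g ∷ gs)) + g b * nestedSum a d (map (reflectAt K) gs)
    ≡⟨ cong (λ x → nestedSum (suc b) d (reverse (g ∷ gs)) + g b * x) (nestedSum-reflect d a (suc b) K a+d+1+b≡K gs) ⟩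
  nestedSum (suc b) d (reverse (g ∷ gs)) + g b * nestedSum (suc b) d (reverse gs)
    ≡⟨ cong (λ l → nestedSum (suc b) d l + g b * nestedSum (suc b) d (reverse gs)) (List.unfold-reverse g gs) ⟩
  nestedSum (suc b) d (reverse gs ∷ʳ g) + g b * nestedSum (suc b) d (reverse gs)
    ≡⟨ nestedSum-lowest d b (reverse gs) g ⟨
  nestedSum b (suc d) (reverse gs ∷ʳ g)
    ≡⟨ cong (nestedSum b (suc d)) (List.unfold-reverse g gs) ⟨
  nestedSum b (suc d) (reverse (g ∷ gs)) ∎
  where
  a+d+1+b≡K : a ℕ.+ d ℕ.+ suc b ≡ K
  a+d+1+b≡K = trans (ℕ.+-suc (a ℕ.+ d) b) (trans (cong (ℕ._+ b) (sym (ℕ.+-suc a d))) a+d+b≡K)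
  index : K ∸ suc (a ℕ.+ d) ≡ b
  index = begin
    K ∸ suc (a ℕ.+ d)                      ≡⟨ cong (_∸ suc (a ℕ.+ d)) a+d+1+b≡K ⟨
    a ℕ.+ d ℕ.+ suc b ∸ suc (a ℕ.+ d)      ≡⟨ cong (_∸ suc (a ℕ.+ d)) (ℕ.+-suc (a ℕ.+ d) b) ⟩
    suc (a ℕ.+ d) ℕ.+ b ∸ suc (a ℕ.+ d)    ≡⟨ ℕ.m+n∸m≡n (suc (a ℕ.+ d)) b ⟩
    b                                      ∎

nestedSum-map-cong : ∀ {A : Set} a d {f g : A → ℕ → ℚ} (xs : List A) →
  (∀ x m → f x m ≡ g x m) → nestedSum a d (map f xs) ≡ nestedSum a d (map g xs)
nestedSum-map-cong a d       []       f≡g = refl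
nestedSum-map-cong a zero    (x ∷ xs) f≡g = refl
nestedSum-map-cong a (suc d) (x ∷ xs) f≡g = cong₂ _+_
  (nestedSum-map-cong a d (x ∷ xs) f≡g) (cong₂ _*_ (f≡g x (a ℕ.+ d)) (nestedSum-map-cong a d xs f≡g))

nestedSum-homogeneous : ∀ a d c (f : ℕ⁺ → ℕ → ℚ) s →
  nestedSum a d (map (λ x m → c ^ val x * f x m) s) ≡ c ^ weight s * nestedSum a d (map f s)
nestedSum-homogeneous a d       c f []      = sym (ℚ.*-identityʳ 1ℚ)
nestedSum-homogeneous a zero    c f (x ∷ s) = sym (ℚ.*-zeroʳ (c ^ weight (x ∷ s)))
nestedSum-homogeneous a (suc d) c f (x ∷ s) = begin
  nestedSum a d (map f′ (x ∷ s)) + c ^ val x * f x (a ℕ.+ d) * nestedSum a d (map f′ s)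
    ≡⟨ cong₂ (λ y z → y + c ^ val x * f x (a ℕ.+ d) * z) (nestedSum-homogeneous a d c f (x ∷ s)) (nestedSum-homogeneous a d c f s) ⟩
  c ^ weight (x ∷ s) * N₁ + c ^ val x * f x (a ℕ.+ d) * (c ^ weight s * N₂)
    ≡⟨ cong (λ y → y * N₁ + c ^ val x * f x (a ℕ.+ d) * (c ^ weight s * N₂)) (^-homo-* c (val x) (weight s)) ⟩
  c ^ val x * c ^ weight s * N₁ + c ^ val x * f x (a ℕ.+ d) * (c ^ weight s * N₂)
    ≡⟨ solve 5 (λ cx cs N₁ fx N₂ → cx :* cs :* N₁ :+ cx :* fx :* (cs :* N₂) := cx :* cs :* (N₁ :+ fx :* N₂))
         refl (c ^ val x) (c ^ weight s) N₁ (f x (a ℕ.+ d)) N₂ ⟩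
  c ^ val x * c ^ weight s * (N₁ + f x (a ℕ.+ d) * N₂)
    ≡⟨ cong (_* (N₁ + f x (a ℕ.+ d) * N₂)) (^-homo-* c (val x) (weight s)) ⟨
  c ^ weight (x ∷ s) * (N₁ + f x (a ℕ.+ d) * N₂) ∎
  where
  f′ = λ x m → c ^ val x * f x m
  N₁ = nestedSum a d (map f (x ∷ s))
  N₂ = nestedSum a d (map f s)

H-as-nestedSum : ∀ M s → H M s ≡ nestedSum 0 M (map (λ a m → invPow m (val a)) s)
H-as-nestedSum M       []      = refl
H-as-nestedSum zero    (a ∷ s) = refl
H-as-nestedSum (suc M) (a ∷ s) = cong₂ (λ x y → x + invPow M (val a) * y) (H-as-nestedSum M (a ∷ s)) (H-as-nestedSum M s)

-- Divisibility by powers of a prime in ℤ₍ₚ₎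

module PowerDivisibility (p : ℕ) (p-prime : Prime p) where

  p∤1 : ¬ p ∣ 1
  p∤1 p∣1 = ¬prime[1] (subst Prime (ℕ.∣1⇒≡1 p∣1) p-prime)

  p∤* : ∀ {a b} → ¬ p ∣ a → ¬ p ∣ b → ¬ p ∣ a ℕ.* b
  p∤* {a} {b} p∤a p∤b p∣ab with euclidsLemma a b p-prime p∣ab
  ... | inj₁ p∣a = p∤a p∣a
  ... | inj₂ p∣b = p∤b p∣b

  coprime-^ : ∀ N {b} → ¬ p ∣ b → Coprime (p ℕ.^ N) b
  coprime-^ zero    p∤b (d∣1 , _)   = ℕ.∣1⇒≡1 d∣1
  coprime-^ (suc N) {b} p∤b {d} (d∣pp^N , d∣b) =
    coprime-p (coprime-divisor d⊥p^N (ℕ.∣-trans d∣pp^N (ℕ.∣-reflexive (ℕ.*-comm p (p ℕ.^ N)))) , d∣b)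
    where
    coprime-p : Coprime p b
    coprime-p (e∣p , e∣b) with prime⇒irreducible p-prime e∣p
    ... | inj₁ e≡1 = e≡1
    ... | inj₂ refl = ⊥-elim (p∤b e∣b)
    d⊥p^N : Coprime d (p ℕ.^ N)
    d⊥p^N (e∣d , e∣p^N) = coprime-^ N p∤b (e∣p^N , ℕ.∣-trans e∣d d∣b)

  -- x ∈ p^N ℤ₍ₚ₎, witnessed by a fraction that need not be in lowest terms
  record p^_∣_ (N : ℕ) (x : ℚ) : Set where
    constructor fraction
    field
      witness     : ℚᵘ
      x≃witness   : ℚ.toℚᵘ x ℚᵘ.≃ witness
      p∤den       : ¬ p ∣ ℚᵘ.↧ₙ witness
      p^N∣num     : p ℕ.^ N ∣ ℤ.∣ ℚᵘ.↥ witness ∣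

  p^∣-fraction : ∀ N a d → ¬ p ∣ suc d → p ℕ.^ N ∣ ℤ.∣ a ∣ → p^ N ∣ (a ℚ./ suc d)
  p^∣-fraction N a d = fraction (mkℚᵘ a d) (ℚ.toℚᵘ-fromℚᵘ (mkℚᵘ a d))

  p^0∣ : ∀ x → ¬ p ∣ ℚ.↧ₙ x → p^ 0 ∣ x
  p^0∣ x@(mkℚ _ _ _) p∤den = fraction (ℚ.toℚᵘ x) ℚᵘ.≃-refl p∤den (ℕ.1∣ _)

  p^0∣ℕtoℚ : ∀ n → p^ 0 ∣ ℕtoℚ n
  p^0∣ℕtoℚ n = p^∣-fraction 0 (ℤ.+ n) 0 p∤1 (ℕ.1∣ _)

  p^∣0 : ∀ N → p^ N ∣ 0ℚ
  p^∣0 N = fraction (mkℚᵘ (ℤ.+ 0) 0) (*≡* refl) p∤1 (ℕ._∣0 _)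

  p^∣-weaken : ∀ {N M x} → M ≤ N → p^ N ∣ x → p^ M ∣ x
  p^∣-weaken {N} {M} M≤N (fraction u x≃u p∤d p^N∣c) = fraction u x≃u p∤d (ℕ.∣-trans p^M∣p^N p^N∣c)
    where
    p^M∣p^N : p ℕ.^ M ∣ p ℕ.^ N
    p^M∣p^N = ℕ.∣-trans (ℕ.m∣m*n (p ℕ.^ (N ∸ M)))
      (ℕ.∣-reflexive (trans (sym (ℕ.^-distribˡ-+-* p M (N ∸ M))) (cong (p ℕ.^_) (ℕ.m+[n∸m]≡n M≤N))))

  p^∣-+ : ∀ {N x y} → p^ N ∣ x → p^ N ∣ y → p^ N ∣ (x + y)
  p^∣-+ {N} {x} {y} (fraction u@(mkℚᵘ a b) x≃u p∤b p^N∣a) (fraction v@(mkℚᵘ c d) y≃v p∤d p^N∣c) =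
    fraction (u ℚᵘ.+ v) (ℚᵘ.≃-trans (ℚ.toℚᵘ-homo-+ x y) (ℚᵘ.+-cong x≃u y≃v)) (p∤* p∤b p∤d)
      (ℤ.∣⇒∣ᵤ {k} (ℤ.∣m∣n⇒∣m+n {k} (ℤ.∣m⇒∣m*n {k} {a} (ℤ.+ suc d) (ℤ.∣ᵤ⇒∣ {k} {a} p^N∣a))
                                    (ℤ.∣m⇒∣m*n {k} {c} (ℤ.+ suc b) (ℤ.∣ᵤ⇒∣ {k} {c} p^N∣c))))
    where k = ℤ.+ (p ℕ.^ N)

  p^∣-neg : ∀ {N x} → p^ N ∣ x → p^ N ∣ (- x)
  p^∣-neg {N} {x} (fraction u@(mkℚᵘ a b) x≃u p∤b p^N∣a) =
    fraction (ℚᵘ.- u) (ℚᵘ.≃-trans (ℚ.toℚᵘ-homo‿- x) (ℚᵘ.-‿cong x≃u)) p∤b (subst (p ℕ.^ N ∣_) (sym (ℤ.∣-i∣≡∣i∣ a)) p^N∣a)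

  p^∣-- : ∀ {N x y} → p^ N ∣ x → p^ N ∣ y → p^ N ∣ (x - y)
  p^∣-- p^N∣x p^N∣y = p^∣-+ p^N∣x (p^∣-neg p^N∣y)

  p^∣-* : ∀ {N M x y} → p^ N ∣ x → p^ M ∣ y → p^ (N ℕ.+ M) ∣ (x * y)
  p^∣-* {N} {M} {x} {y} (fraction u@(mkℚᵘ a b) x≃u p∤b p^N∣a) (fraction v@(mkℚᵘ c d) y≃v p∤d p^M∣c) =
    fraction (u ℚᵘ.* v) (ℚᵘ.≃-trans (ℚ.toℚᵘ-homo-* x y) (ℚᵘ.*-cong x≃u y≃v)) (p∤* p∤b p∤d)
      (subst₂ _∣_ (sym (ℕ.^-distribˡ-+-* p N M)) (sym (ℤ.abs-* a c)) (ℕ.*-pres-∣ p^N∣a p^M∣c))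

  p^∣-^ : ∀ {N x} n → p^ N ∣ x → p^ (n ℕ.* N) ∣ (x ^ n)
  p^∣-^ zero    _     = p^0∣ℕtoℚ 1
  p^∣-^ (suc n) p^N∣x = p^∣-* p^N∣x (p^∣-^ n p^N∣x)

  p^∣⇒InPowZp : ∀ {N x} → p^ N ∣ x → InPowZp p N x
  p^∣⇒InPowZp {N} {x@(mkℚ a b a⊥b)} (fraction u@(mkℚᵘ c d) (*≡* ad≡cb) p∤d p^N∣c) = p∤b , p^N∣a
    where
    |a|d≡|c|b : ℤ.∣ a ∣ ℕ.* suc d ≡ ℤ.∣ c ∣ ℕ.* suc b
    |a|d≡|c|b = trans (sym (ℤ.abs-* a (ℤ.+ suc d))) (trans (cong ℤ.∣_∣ ad≡cb) (ℤ.abs-* c (ℤ.+ suc b)))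
    b∣d : suc b ∣ suc d
    b∣d = coprime-divisor (Coprime.sym (Coprime.recompute a⊥b))
            (ℕ.∣-trans (ℕ.n∣m*n ℤ.∣ c ∣) (ℕ.∣-reflexive (sym |a|d≡|c|b)))
    p∤b : ¬ p ∣ suc b
    p∤b p∣b = p∤d (ℕ.∣-trans p∣b b∣d)
    p^N∣a : p ℕ.^ N ∣ ℤ.∣ a ∣
    p^N∣a = coprime-divisor (coprime-^ N p∤d)
      (ℕ.∣-trans (ℕ.∣m⇒∣m*n (suc b) p^N∣c) (ℕ.∣-reflexive (trans (sym |a|d≡|c|b) (ℕ.*-comm ℤ.∣ a ∣ (suc d)))))

  p^∣-∑< : ∀ {N} K f → (∀ i → i < K → p^ N ∣ f i) → p^ N ∣ ∑< K f
  p^∣-∑< zero    f p^N∣f = p^∣0 _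
  p^∣-∑< (suc K) f p^N∣f = p^∣-+ (p^N∣f 0 (s≤s z≤n)) (p^∣-∑< K (f ∘ suc) (λ i i<K → p^N∣f (suc i) (s≤s i<K)))

  p^∣-∑Comp : ∀ {N} w k F → (∀ t → weight t ≡ w ℕ.+ k → p^ N ∣ F t) → p^ N ∣ ∑Comp w k F
  p^∣-∑Comp zero    zero    F p^N∣F = p^N∣F [] refl
  p^∣-∑Comp zero    (suc k) F p^N∣F = p^∣0 _
  p^∣-∑Comp (suc w) k       F p^N∣F = p^∣-+
    (p^∣-∑Comp w (suc k) F (λ t wt → p^N∣F t (trans wt (ℕ.+-suc w k))))
    (p^∣-∑Comp w 0 _ (λ t wt → p^N∣F ((1+ k) ∷ t) (weight-∷ w k t wt)))

  p^∣-∑Comp< : ∀ {N} K F → (∀ t → weight t < K → p^ N ∣ F t) → p^ N ∣ ∑Comp< K F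
  p^∣-∑Comp< K F p^N∣F = p^∣-∑< K _ (λ w w<K → p^∣-∑Comp w 0 F
    (λ t wt → p^N∣F t (subst (_< K) (sym (trans wt (ℕ.+-identityʳ w))) w<K)))


  -- r = u + u r makes r^(e+1) the binomial series Σᵢ (i choose e) u^(i+1), and p ∣ u bounds its tail
  binomialSeries-truncation : ∀ {u r} → u * (1ℚ + r) ≡ r → p^ 1 ∣ u → p^ 0 ∣ r →
    ∀ K e → p^ K ∣ (binomialSeries u e K - r ^ suc e)
  binomialSeries-truncation {u} {r} u[1+r]≡r p∣u p^0∣r = truncation
    where
    truncation : ∀ K e → p^ K ∣ (binomialSeries u e K - r ^ suc e)
    truncation zero    e       = p^∣-- (p^∣0 0) (p^∣-weaken z≤n (p^∣-^ (suc e) p^0∣r))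
    truncation (suc K) zero    = subst (p^ suc K ∣_) step (p^∣-* p∣u (truncation K 0))
      where
      step : u * (binomialSeries u 0 K - r * 1ℚ) ≡ binomialSeries u 0 (suc K) - r * 1ℚ
      step = begin
        u * (binomialSeries u 0 K - r * 1ℚ)
          ≡⟨ solve 3 (λ u b r → u :* (b :- r :* con 1ℚ) := u :* (con 1ℚ :+ b) :- u :* (con 1ℚ :+ r) :* con 1ℚ)
               refl u (binomialSeries u 0 K) r ⟩
        u * (1ℚ + binomialSeries u 0 K) - u * (1ℚ + r) * 1ℚ
          ≡⟨ cong₂ _-_ (binomialSeries-0-suc u K) (cong (_* 1ℚ) (sym u[1+r]≡r)) ⟨
        binomialSeries u 0 (suc K) - r * 1ℚ ∎
    truncation (suc K) (suc e) =
      subst (p^ suc K ∣_) step (p^∣-* p∣u (p^∣-+ (truncation K e) (truncation K (suc e))))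
      where
      step : u * ((binomialSeries u e K - r ^ suc e) + (binomialSeries u (suc e) K - r * r ^ suc e))
           ≡ binomialSeries u (suc e) (suc K) - r * r ^ suc e
      step = begin
        u * ((binomialSeries u e K - r ^ suc e) + (binomialSeries u (suc e) K - r * r ^ suc e))
          ≡⟨ solve 5 (λ u a b r x → u :* ((a :- x) :+ (b :- r :* x)) := u :* (a :+ b) :- u :* (con 1ℚ :+ r) :* x)
               refl u (binomialSeries u e K) (binomialSeries u (suc e) K) r (r ^ suc e) ⟩
        u * (binomialSeries u e K + binomialSeries u (suc e) K) - u * (1ℚ + r) * r ^ suc e
          ≡⟨ cong₂ _-_ (binomialSeries-suc-suc u e K) (cong (_* r ^ suc e) (sym u[1+r]≡r)) ⟨
        binomialSeries u (suc e) (suc K) - r * r ^ suc e ∎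

-- Comparing the two sides prime by prime

module Comparison (p : ℕ) (p-prime : Prime p) where
  open PowerDivisibility p p-prime

  P : ℕ
  P = p ∸ 1

  p≡1+P : p ≡ suc P
  p≡1+P = sym (ℕ.suc-pred p {{prime⇒nonZero p-prime}})

  scaledH : ℕ → Comp → ℚ
  scaledH M t = ℕtoℚ (p ℕ.^ weight t) * H M t

  Φ₁-scaledH : ℕ → Comp → ℕ → ℚ
  Φ₁-scaledH M s K = ∑Comp< K (λ t → Φ₁-coef s t * scaledH M t)

  -- u m = p/(m+1) and ρ m = -p/(p-1-m) = u m / (1 - u m)
  u ρ : ℕ → ℚ
  u m = ℕtoℚ p * (ℤ.+ 1 ℚ./ suc m)
  ρ m = - (ℕtoℚ p * (ℤ.+ 1 ℚ./ suc (P ∸ suc m)))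

  reflectedH : ℕ → Comp → ℚ
  reflectedH M s = nestedSum 0 M (map (λ a m → ρ m ^ val a) s)

  p∤1+ : ∀ {n} → n < P → ¬ p ∣ suc n
  p∤1+ n<P p∣1+n = ℕ.<⇒≱ (subst (_ <_) (sym p≡1+P) (s≤s n<P)) (ℕ.∣⇒≤ p∣1+n)

  p∣p : p^ 1 ∣ ℕtoℚ p
  p∣p = p^∣-fraction 1 (ℤ.+ p) 0 p∤1 (ℕ.∣-reflexive (ℕ.*-identityʳ p))

  p∣u : ∀ {m} → m < P → p^ 1 ∣ u m
  p∣u {m} m<P = p^∣-* p∣p (p^∣-fraction 0 (ℤ.+ 1) m (p∤1+ m<P) (ℕ.1∣ _))

  p∣ρ : ∀ {m} → m < P → p^ 1 ∣ ρ m
  p∣ρ {m} m<P = p^∣-neg (p^∣-* p∣p (p^∣-fraction 0 (ℤ.+ 1) (P ∸ suc m) (p∤1+ P-1-m<P) (ℕ.1∣ _)))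
    where
    P-1-m<P : P ∸ suc m < P
    P-1-m<P = subst (_≤ P) (ℕ.+-∸-assoc 1 m<P) (ℕ.m∸n≤m P m)

  u[1+ρ]≡ρ : ∀ {m} → m < P → u m * (1ℚ + ρ m) ≡ ρ m
  u[1+ρ]≡ρ {m} m<P = begin
    q * i₁ * (1ℚ + - (q * i₂))
      ≡⟨ cong (λ x → x * i₁ * (1ℚ + - (x * i₂))) p≡m₁+m₂ ⟩
    (m₁ + m₂) * i₁ * (1ℚ + - ((m₁ + m₂) * i₂))
      ≡⟨ solve 4 (λ a b x y → (a :+ b) :* x :* (con 1ℚ :+ :- ((a :+ b) :* y))
                   := :- ((a :+ b) :* y) :+ (a :+ b) :* (x :* (con 1ℚ :- b :* y) :+ y :* (con 1ℚ :- a :* x))) refl m₁ m₂ i₁ i₂ ⟩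
    - ((m₁ + m₂) * i₂) + (m₁ + m₂) * (i₁ * (1ℚ - m₂ * i₂) + i₂ * (1ℚ - m₁ * i₁))
      ≡⟨ cong₂ (λ x y → - ((m₁ + m₂) * i₂) + (m₁ + m₂) * (i₁ * (1ℚ - x) + i₂ * (1ℚ - y)))
               (ℕtoℚ-*-inverse (P ∸ suc m)) (ℕtoℚ-*-inverse m) ⟩
    - ((m₁ + m₂) * i₂) + (m₁ + m₂) * (i₁ * (1ℚ - 1ℚ) + i₂ * (1ℚ - 1ℚ))
      ≡⟨ solve 4 (λ a b x y → :- ((a :+ b) :* y) :+ (a :+ b) :* (x :* (con 1ℚ :- con 1ℚ) :+ y :* (con 1ℚ :- con 1ℚ))
                   := :- ((a :+ b) :* y)) refl m₁ m₂ i₁ i₂ ⟩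
    - ((m₁ + m₂) * i₂)
      ≡⟨ cong (λ x → - (x * i₂)) p≡m₁+m₂ ⟨
    - (q * i₂) ∎
    where
    q  = ℕtoℚ p
    m₁ = ℕtoℚ (suc m)
    m₂ = ℕtoℚ (suc (P ∸ suc m))
    i₁ = ℤ.+ 1 ℚ./ suc m
    i₂ = ℤ.+ 1 ℚ./ suc (P ∸ suc m)
    p≡m₁+m₂ : q ≡ m₁ + m₂
    p≡m₁+m₂ = trans (cong ℕtoℚ (begin
      p                           ≡⟨ p≡1+P ⟩
      suc P                       ≡⟨ cong suc (ℕ.m+[n∸m]≡n m<P) ⟨
      suc (suc m ℕ.+ (P ∸ suc m)) ≡⟨ ℕ.+-suc (suc m) (P ∸ suc m) ⟨
      suc m ℕ.+ suc (P ∸ suc m)   ∎)) (ℕtoℚ-homo-+ (suc m) (suc (P ∸ suc m)))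

  p^0∣reflectedH : ∀ {M} → M ≤ P → ∀ s → p^ 0 ∣ reflectedH M s
  p^0∣reflectedH {M}     M≤P []            = p^0∣ℕtoℚ 1
  p^0∣reflectedH {zero}  M≤P (a ∷ s)       = p^∣0 0
  p^0∣reflectedH {suc M} M<P ((1+ e) ∷ s) = p^∣-+ (p^0∣reflectedH M≤P ((1+ e) ∷ s))
    (p^∣-* (p^∣-weaken z≤n (p^∣-^ (suc e) (p∣ρ M<P))) (p^0∣reflectedH M≤P s))
    where M≤P = ℕ.<⇒≤ M<P

  Φ₁-scaledH-[] : ∀ M K → Φ₁-scaledH M [] (suc K) ≡ 1ℚ
  Φ₁-scaledH-[] M K = trans (∑Comp<-extend {1} {suc K} (λ t → Φ₁-coef [] t * scaledH M t) (s≤s z≤n) vanishes) refl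
    where
    vanishes : ∀ t → 1 ≤ weight t → Φ₁-coef [] t * scaledH M t ≡ 0ℚ
    vanishes (a ∷ t) _ = trans (cong (_* scaledH M (a ∷ t)) (Φ₁-coef-[]-∷ a t)) (ℚ.*-zeroˡ (scaledH M (a ∷ t)))

  Φ₁-scaledH-zero : ∀ a s K → Φ₁-scaledH 0 (a ∷ s) K ≡ 0ℚ
  Φ₁-scaledH-zero a s K = trans (∑Comp<-cong K (λ t _ → vanishes t)) (∑Comp<-zero K)
    where
    vanishes : ∀ t → Φ₁-coef (a ∷ s) t * scaledH 0 t ≡ 0ℚ
    vanishes []      = trans (cong (_* scaledH 0 []) (Φ₁-coef-∷-[] a s)) (ℚ.*-zeroˡ (scaledH 0 []))
    vanishes (b ∷ t) = trans (cong (Φ₁-coef (a ∷ s) (b ∷ t) *_) (ℚ.*-zeroʳ (ℕtoℚ (p ℕ.^ weight (b ∷ t)))))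
                             (ℚ.*-zeroʳ (Φ₁-coef (a ∷ s) (b ∷ t)))

  -- raising the bound of the harmonic sum from M to M+1 adds the terms whose first index is M+1
  Φ₁-scaledH-suc : ∀ M e s K → Φ₁-scaledH (suc M) ((1+ e) ∷ s) K
    ≡ Φ₁-scaledH M ((1+ e) ∷ s) K + ∑< K (λ i → ℕtoℚ (i C e) * u M ^ suc i * Φ₁-scaledH M s (K ∸ suc i))
  Φ₁-scaledH-suc M e s K = begin
    ∑Comp< K (λ t → Φ₁-coef a∷s t * scaledH (suc M) t)
      ≡⟨ ∑Comp<-cong K (λ t _ → split t) ⟩
    ∑Comp< K (λ t → Φ₁-coef a∷s t * scaledH M t + newTerms t)
      ≡⟨ ∑Comp<-distrib-+ K _ newTerms ⟩
    Φ₁-scaledH M a∷s K + ∑Comp< K newTerms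
      ≡⟨ cong (Φ₁-scaledH M a∷s K +_) (∑Comp-factor-head (λ j → ℕtoℚ (j C e) * u M ^ suc j) refl factor K 0) ⟩
    Φ₁-scaledH M a∷s K + ∑< K (λ i → ℕtoℚ (i C e) * u M ^ suc i * Φ₁-scaledH M s (K ∸ suc i)) ∎
    where
    a∷s = (1+ e) ∷ s
    newTerms : Comp → ℚ
    newTerms []      = 0ℚ
    newTerms (b ∷ t) = Φ₁-coef a∷s (b ∷ t) * (ℕtoℚ (p ℕ.^ weight (b ∷ t)) * (invPow M (val b) * H M t))
    split : ∀ t → Φ₁-coef a∷s t * scaledH (suc M) t ≡ Φ₁-coef a∷s t * scaledH M t + newTerms t
    split []      = begin
      Φ₁-coef a∷s [] * scaledH (suc M) []      ≡⟨ cong (_* scaledH (suc M) []) (Φ₁-coef-∷-[] (1+ e) s) ⟩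
      0ℚ * scaledH (suc M) []                  ≡⟨ solve 2 (λ x y → con 0ℚ :* x := con 0ℚ :* y :+ con 0ℚ) refl (scaledH (suc M) []) (scaledH M []) ⟩
      0ℚ * scaledH M [] + 0ℚ                   ≡⟨ cong (λ c → c * scaledH M [] + 0ℚ) (Φ₁-coef-∷-[] (1+ e) s) ⟨
      Φ₁-coef a∷s [] * scaledH M [] + 0ℚ       ∎
    split (b ∷ t) = solve 5 (λ c q h₁ i h₂ → c :* (q :* (h₁ :+ i :* h₂)) := c :* (q :* h₁) :+ c :* (q :* (i :* h₂)))
      refl (Φ₁-coef a∷s (b ∷ t)) (ℕtoℚ (p ℕ.^ weight (b ∷ t))) (H M (b ∷ t)) (invPow M (val b)) (H M t)
    factor : ∀ j t → newTerms ((1+ j) ∷ t) ≡ ℕtoℚ (j C e) * u M ^ suc j * (Φ₁-coef s t * scaledH M t)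
    factor j t = begin
      Φ₁-coef a∷s ((1+ j) ∷ t) * (ℕtoℚ (p ℕ.^ (suc j ℕ.+ weight t)) * (invPow M (suc j) * H M t))
        ≡⟨ cong₂ (λ c x → c * (x * (invPow M (suc j) * H M t))) (Φ₁-coef-∷-∷ e j s t) p^[j+1+w] ⟩
      ℕtoℚ (j C e) * Φ₁-coef s t * (q ^ suc j * ℕtoℚ (p ℕ.^ weight t) * (invPow M (suc j) * H M t))
        ≡⟨ cong (λ x → ℕtoℚ (j C e) * Φ₁-coef s t * (q ^ suc j * ℕtoℚ (p ℕ.^ weight t) * (x * H M t))) (invPow≡^ M (suc j)) ⟩
      ℕtoℚ (j C e) * Φ₁-coef s t * (q ^ suc j * ℕtoℚ (p ℕ.^ weight t) * (i ^ suc j * H M t))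
        ≡⟨ solve 6 (λ b c x w y h → b :* c :* (x :* w :* (y :* h)) := b :* (x :* y) :* (c :* (w :* h)))
             refl (ℕtoℚ (j C e)) (Φ₁-coef s t) (q ^ suc j) (ℕtoℚ (p ℕ.^ weight t)) (i ^ suc j) (H M t) ⟩
      ℕtoℚ (j C e) * (q ^ suc j * i ^ suc j) * (Φ₁-coef s t * scaledH M t)
        ≡⟨ cong (λ x → ℕtoℚ (j C e) * x * (Φ₁-coef s t * scaledH M t)) (^-distrib-* q i (suc j)) ⟨
      ℕtoℚ (j C e) * u M ^ suc j * (Φ₁-coef s t * scaledH M t) ∎
      where
      q = ℕtoℚ p
      i = ℤ.+ 1 ℚ./ suc M
      p^[j+1+w] : ℕtoℚ (p ℕ.^ (suc j ℕ.+ weight t)) ≡ q ^ suc j * ℕtoℚ (p ℕ.^ weight t)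
      p^[j+1+w] = begin
        ℕtoℚ (p ℕ.^ (suc j ℕ.+ weight t))              ≡⟨ cong ℕtoℚ (ℕ.^-distribˡ-+-* p (suc j) (weight t)) ⟩
        ℕtoℚ (p ℕ.^ suc j ℕ.* p ℕ.^ weight t)          ≡⟨ ℕtoℚ-homo-* (p ℕ.^ suc j) (p ℕ.^ weight t) ⟩
        ℕtoℚ (p ℕ.^ suc j) * ℕtoℚ (p ℕ.^ weight t)     ≡⟨ cong (_* ℕtoℚ (p ℕ.^ weight t)) (ℕtoℚ-homo-^ p (suc j)) ⟩
        q ^ suc j * ℕtoℚ (p ℕ.^ weight t)              ∎

  p^K∣Φ₁-scaledH-reflectedH : ∀ {M} → M ≤ P → ∀ s K → p^ K ∣ (Φ₁-scaledH M s K - reflectedH M s)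
  p^K∣Φ₁-scaledH-reflectedH {M} M≤P [] zero = p^∣-- (p^∣0 0) (p^0∣ℕtoℚ 1)
  p^K∣Φ₁-scaledH-reflectedH {M} M≤P [] (suc K) =
    subst (p^ suc K ∣_) (sym (trans (cong (_- 1ℚ) (Φ₁-scaledH-[] M K)) (ℚ.+-inverseʳ 1ℚ))) (p^∣0 _)
  p^K∣Φ₁-scaledH-reflectedH {zero} M≤P (a ∷ s) K =
    subst (p^ K ∣_) (sym (trans (cong (_- 0ℚ) (Φ₁-scaledH-zero a s K)) (ℚ.+-inverseʳ 0ℚ))) (p^∣0 _)
  p^K∣Φ₁-scaledH-reflectedH {suc M} M<P ((1+ e) ∷ s) K =
    subst (p^ K ∣_) (sym decomposition) (p^∣-+ (p^∣-+ previous-bound sum-of-corrections) binomial-correction)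
    where
    M≤P = ℕ.<⇒≤ M<P
    Ψ : ℕ → ℚ
    Ψ i = ℕtoℚ (i C e) * u M ^ suc i
    L₁ = Φ₁-scaledH M ((1+ e) ∷ s) K
    R₁ = reflectedH M ((1+ e) ∷ s)
    R  = reflectedH M s
    Lᵢ : ℕ → ℚ
    Lᵢ i = Φ₁-scaledH M s (K ∸ suc i)
    decomposition : Φ₁-scaledH (suc M) ((1+ e) ∷ s) K - (R₁ + ρ M ^ suc e * R)
                  ≡ (L₁ - R₁) + ∑< K (λ i → Ψ i * (Lᵢ i - R)) + (binomialSeries (u M) e K - ρ M ^ suc e) * R
    decomposition = begin
      Φ₁-scaledH (suc M) ((1+ e) ∷ s) K - (R₁ + ρ M ^ suc e * R)
        ≡⟨ cong (_- (R₁ + ρ M ^ suc e * R)) (Φ₁-scaledH-suc M e s K) ⟩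
      L₁ + ∑< K (λ i → Ψ i * Lᵢ i) - (R₁ + ρ M ^ suc e * R)
        ≡⟨ cong (λ x → L₁ + x - (R₁ + ρ M ^ suc e * R)) (∑<-cong K (λ i _ →
             solve 3 (λ ψ l r → ψ :* l := ψ :* (l :- r) :+ r :* ψ) refl (Ψ i) (Lᵢ i) R)) ⟩
      L₁ + ∑< K (λ i → Ψ i * (Lᵢ i - R) + R * Ψ i) - (R₁ + ρ M ^ suc e * R)
        ≡⟨ cong (λ x → L₁ + x - (R₁ + ρ M ^ suc e * R)) (trans (∑<-distrib-+ K _ _)
             (cong (∑< K (λ i → Ψ i * (Lᵢ i - R)) +_) (sym (*-distribˡ-∑< K R Ψ)))) ⟩
      L₁ + (∑< K (λ i → Ψ i * (Lᵢ i - R)) + R * binomialSeries (u M) e K) - (R₁ + ρ M ^ suc e * R)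
        ≡⟨ solve 6 (λ l₁ r₁ x r b y → l₁ :+ (x :+ r :* b) :- (r₁ :+ y :* r) := (l₁ :- r₁) :+ x :+ (b :- y) :* r)
             refl L₁ R₁ (∑< K (λ i → Ψ i * (Lᵢ i - R))) R (binomialSeries (u M) e K) (ρ M ^ suc e) ⟩
      (L₁ - R₁) + ∑< K (λ i → Ψ i * (Lᵢ i - R)) + (binomialSeries (u M) e K - ρ M ^ suc e) * R ∎
    previous-bound : p^ K ∣ (L₁ - R₁)
    previous-bound = p^K∣Φ₁-scaledH-reflectedH M≤P ((1+ e) ∷ s) K
    sum-of-corrections : p^ K ∣ ∑< K (λ i → Ψ i * (Lᵢ i - R))
    sum-of-corrections = p^∣-∑< K _ (λ i i<K → subst (p^_∣ (Ψ i * (Lᵢ i - R))) (exponent i<K)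
      (p^∣-* (p^∣-* (p^0∣ℕtoℚ (i C e)) (p^∣-^ (suc i) (p∣u M<P))) (p^K∣Φ₁-scaledH-reflectedH M≤P s (K ∸ suc i))))
      where
      exponent : ∀ {i} → i < K → suc i ℕ.* 1 ℕ.+ (K ∸ suc i) ≡ K
      exponent {i} i<K = trans (cong (ℕ._+ (K ∸ suc i)) (ℕ.*-identityʳ (suc i))) (ℕ.m+[n∸m]≡n i<K)
    binomial-correction : p^ K ∣ ((binomialSeries (u M) e K - ρ M ^ suc e) * R)
    binomial-correction = subst (p^_∣ ((binomialSeries (u M) e K - ρ M ^ suc e) * R)) (ℕ.+-identityʳ K) (p^∣-* (binomialSeries-truncation
      (u[1+ρ]≡ρ M<P) (p∣u M<P) (p^∣-weaken z≤n (p∣ρ M<P)) K e) (p^0∣reflectedH M≤P s))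

  -- n ↦ p - n turns p/n into -p/(p - n): ψ₁ corresponds to H_{p-1} with 1/n replaced by ρ
  reflectedH-reverse : ∀ s → sign (weight s) * scaledH P (reverse s) ≡ reflectedH P s
  reflectedH-reverse s = begin
    sign w * (ℕtoℚ (p ℕ.^ weight (reverse s)) * H P (reverse s))
      ≡⟨ cong₂ (λ v h → sign w * (ℕtoℚ (p ℕ.^ v) * h)) (weight-reverse s) (H-as-nestedSum P (reverse s)) ⟩
    sign w * (ℕtoℚ (p ℕ.^ w) * nestedSum 0 P (map hw (reverse s)))
      ≡⟨ cong (λ l → sign w * (ℕtoℚ (p ℕ.^ w) * nestedSum 0 P l)) (List.reverse-map hw s) ⟩
    sign w * (ℕtoℚ (p ℕ.^ w) * nestedSum 0 P (reverse (map hw s)))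
      ≡⟨ cong (λ x → sign w * (ℕtoℚ (p ℕ.^ w) * x)) (nestedSum-reflect P 0 0 P (ℕ.+-identityʳ P) (map hw s)) ⟨
    sign w * (ℕtoℚ (p ℕ.^ w) * nestedSum 0 P (map (reflectAt P) (map hw s)))
      ≡⟨ cong₂ (λ x l → sign w * (x * nestedSum 0 P l)) (ℕtoℚ-homo-^ p w) (sym (List.map-∘ s)) ⟩
    sign w * (q ^ w * nestedSum 0 P (map (reflectAt P ∘ hw) s))
      ≡⟨ ℚ.*-assoc (sign w) (q ^ w) _ ⟨
    sign w * q ^ w * nestedSum 0 P (map (reflectAt P ∘ hw) s)
      ≡⟨ cong (_* nestedSum 0 P (map (reflectAt P ∘ hw) s)) (-‿^ q w) ⟨
    (- q) ^ w * nestedSum 0 P (map (reflectAt P ∘ hw) s)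
      ≡⟨ nestedSum-homogeneous 0 P (- q) (λ a m → hw a (P ∸ suc m)) s ⟨
    nestedSum 0 P (map (λ a m → (- q) ^ val a * hw a (P ∸ suc m)) s)
      ≡⟨ nestedSum-map-cong 0 P s pointwise ⟩
    reflectedH P s ∎
    where
    w = weight s
    q = ℕtoℚ p
    hw : ℕ⁺ → ℕ → ℚ
    hw a m = invPow m (val a)
    pointwise : ∀ a m → (- q) ^ val a * hw a (P ∸ suc m) ≡ ρ m ^ val a
    pointwise a m = begin
      (- q) ^ val a * invPow (P ∸ suc m) (val a)  ≡⟨ cong ((- q) ^ val a *_) (invPow≡^ (P ∸ suc m) (val a)) ⟩
      (- q) ^ val a * i ^ val a                   ≡⟨ ^-distrib-* (- q) i (val a) ⟨
      (- q * i) ^ val a                           ≡⟨ cong (_^ val a) (ℚ.neg-distribˡ-* q i) ⟨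
      ρ m ^ val a                                 ∎
      where i = ℤ.+ 1 ℚ./ suc (P ∸ suc m)

  truncSum-Φ₁¹-ψ₁ : ∀ α n →
    truncSum (λ t → Φ₁¹ α t - ψ₁ α t) n p ≡ ∑Comp< n (λ s → α s * (Φ₁-scaledH P s n - reflectedH P s))
  truncSum-Φ₁¹-ψ₁ α n = begin
    truncSum (λ t → Φ₁¹ α t - ψ₁ α t) n p
      ≡⟨ truncSum-as-∑Comp< (λ t → Φ₁¹ α t - ψ₁ α t) n p ⟩
    ∑Comp< n (λ t → (Φ₁¹ α t - ψ₁ α t) * scaledH P t)
      ≡⟨ ∑Comp<-cong n (λ t _ → solve 3 (λ a b c → (a :- b) :* c := a :* c :+ :- con 1ℚ :* (b :* c))
                                         refl (Φ₁¹ α t) (ψ₁ α t) (scaledH P t)) ⟩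
    ∑Comp< n (λ t → Φ₁¹ α t * scaledH P t + - 1ℚ * (ψ₁ α t * scaledH P t))
      ≡⟨ ∑Comp<-distrib-+ n _ _ ⟩
    ∑Comp< n (λ t → Φ₁¹ α t * scaledH P t) + ∑Comp< n (λ t → - 1ℚ * (ψ₁ α t * scaledH P t))
      ≡⟨ cong (∑Comp< n (λ t → Φ₁¹ α t * scaledH P t) +_) (*-distribˡ-∑Comp< n (- 1ℚ) _) ⟨
    ∑Comp< n (λ t → Φ₁¹ α t * scaledH P t) + - 1ℚ * ∑Comp< n (λ t → ψ₁ α t * scaledH P t)
      ≡⟨ cong₂ (λ x y → x + - 1ℚ * y) (∑Comp<-Φ₁¹ α n (scaledH P)) (∑Comp<-ψ₁ α n (scaledH P)) ⟩
    ∑Comp< n (λ s → α s * Φ₁-scaledH P s n) + - 1ℚ * ∑Comp< n (λ s → α s * (sign (weight s) * scaledH P (reverse s)))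
      ≡⟨ cong (λ x → ∑Comp< n (λ s → α s * Φ₁-scaledH P s n) + - 1ℚ * x)
              (∑Comp<-cong n (λ s _ → cong (α s *_) (reflectedH-reverse s))) ⟩
    ∑Comp< n (λ s → α s * Φ₁-scaledH P s n) + - 1ℚ * ∑Comp< n (λ s → α s * reflectedH P s)
      ≡⟨ cong (∑Comp< n (λ s → α s * Φ₁-scaledH P s n) +_) (*-distribˡ-∑Comp< n (- 1ℚ) _) ⟩
    ∑Comp< n (λ s → α s * Φ₁-scaledH P s n) + ∑Comp< n (λ s → - 1ℚ * (α s * reflectedH P s))
      ≡⟨ ∑Comp<-distrib-+ n _ _ ⟨
    ∑Comp< n (λ s → α s * Φ₁-scaledH P s n + - 1ℚ * (α s * reflectedH P s))
      ≡⟨ ∑Comp<-cong n (λ s _ → solve 3 (λ a l r → a :* l :+ :- con 1ℚ :* (a :* r) := a :* (l :- r))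
                                         refl (α s) (Φ₁-scaledH P s n) (reflectedH P s)) ⟩
    ∑Comp< n (λ s → α s * (Φ₁-scaledH P s n - reflectedH P s)) ∎

  p^n∣truncSum : ∀ α n → (∀ s → weight s < n → ¬ p ∣ ℚ.↧ₙ (α s)) →
    InPowZp p n (truncSum (λ t → Φ₁¹ α t - ψ₁ α t) n p)
  p^n∣truncSum α n p∤den = p^∣⇒InPowZp (subst (p^ n ∣_) (sym (truncSum-Φ₁¹-ψ₁ α n))
    (p^∣-∑Comp< n _ (λ s ws<n → p^∣-* (p^0∣ (α s) (p∤den s ws<n)) (p^K∣Φ₁-scaledH-reflectedH ℕ.≤-refl s n))))


compsOfWeight-complete : ∀ s → s ∈ compsOfWeight (weight s)
compsOfWeight-complete []           = here refl
compsOfWeight-complete ((1+ k) ∷ t) = extendHead k (compsOfWeight-complete t)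
  where
  extendHead : ∀ k {t} → t ∈ compsOfWeight (weight t) → ((1+ k) ∷ t) ∈ compsOfWeight (suc k ℕ.+ weight t)
  extendHead zero    t∈ = ∈-++⁺ˡ (∈-map⁺ ((1+ 0) ∷_) t∈)
  extendHead (suc k) t∈ = ∈-++⁺ʳ _ (∈-concat⁺′ (here refl) (∈-map⁺ incHead (extendHead k t∈)))

∈⇒≤sum : ∀ {m ms} → m ∈ ms → m ≤ ℕ.sum ms
∈⇒≤sum {ms = m ∷ ms}  (here refl) = ℕ.m≤m+n m (ℕ.sum ms)
∈⇒≤sum {ms = m′ ∷ ms} (there m∈)  = ℕ.≤-trans (∈⇒≤sum m∈) (ℕ.m≤n+m (ℕ.sum ms) m′)

denominatorBound : (Comp → ℚ) → ℕ → ℕ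
denominatorBound α n = ℕ.sum (map (λ w → ℕ.sum (map (ℚ.↧ₙ_ ∘ α) (compsOfWeight w))) (upTo n))

↧ₙ≤denominatorBound : ∀ α {n} s → weight s < n → ℚ.↧ₙ (α s) ≤ denominatorBound α n
↧ₙ≤denominatorBound α s ws<n = ℕ.≤-trans
  (∈⇒≤sum (∈-map⁺ (ℚ.↧ₙ_ ∘ α) (compsOfWeight-complete s)))
  (∈⇒≤sum (∈-map⁺ (λ w → ℕ.sum (map (ℚ.↧ₙ_ ∘ α) (compsOfWeight w))) (∈-upTo⁺ ws<n)))

mainTheorem4 : ∀ (α : Comp → ℚ) → InKerζ̂∞ (λ t → Φ₁¹ α t - ψ₁ α t)
mainTheorem4 α n _ = suc (denominatorBound α n) , λ p p-prime N≤p →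
  Comparison.p^n∣truncSum p p-prime α n (λ s ws<n p∣den →
    ℕ.<⇒≱ (ℕ.<-≤-trans (s≤s (↧ₙ≤denominatorBound α s ws<n)) N≤p) (↧ₙ-divisor≤ (α s) p∣den))
  where
  ↧ₙ-divisor≤ : ∀ x {m} → m ∣ ℚ.↧ₙ x → m ≤ ℚ.↧ₙ x
  ↧ₙ-divisor≤ (mkℚ _ _ _) = ℕ.∣⇒≤
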